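{- There is an isomorphism of right $\mathsf{PlanEq}$-modules $\mathsf{CycPerm}\cong\mathsf{CycEq}\oplus(\overline{\mathsf{CycHam}}\circ\mathsf{PlanEq})$.
   Context: Graphs are finite, simple, undirected; a tube is a nonempty vertex set inducing a connected subgraph; $\Gamma/G$ contracts a tube to a vertex $\{G\}$; for a partition $I$ of $V_\Gamma$ into tubes, $\Gamma/I$ is the contracted graph on the blocks. $\overline{\Gamma}$ is the complement graph; $\mathsf{P}_1$ is the one-vertex graph. Over a field $\mathsf{k}$, collections are indexed by nonempty connected graphs, functorial in isomorphisms; $(\mathcal{V}\circ\mathcal{P})(\Gamma)=\bigoplus_I\mathcal{V}(\Gamma/I)\otimes\bigotimes_{G\in I}\mathcal{P}(\Gamma|_G)$ is the free right $\mathcal{P}$-module on $\mathcal{V}$ for a contractad $\mathcal{P}$. $\mathsf{PlanEq}(\Gamma)$ has basis the orderings $(v_1,\dots,v_n)$ of $V_\Gamma$ that are left-to-right leaf sequences of $\Gamma$-admissible planar binary trees (planar rooted trees with binary internal vertices, leaves labelled bijectively by $V_\Gamma$, leaf set below each vertex a tube), a contractad under substitution of sequences. $\mathsf{CycPerm}(\Gamma)$ has basis all cyclic orderings $[v_1,\dots,v_n]$ of $V_\Gamma$ (orderings modulo rotation), a right $\mathsf{PlanEq}$-module by substituting a sequence of $\Gamma|_G$ for $\{G\}$. $\mathsf{CycEq}(\Gamma)\subseteq\mathsf{CycPerm}(\Gamma)$ is spanned by the cyclic orderings having a representative in $\mathsf{PlanEq}(\Gamma)$ (a submodule). $\overline{\mathsf{CycHam}}(\Gamma)$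 is the vector space with basis the directed Hamiltonian cycles of $\overline{\Gamma}$ (cyclic orderings in which no two cyclically consecutive vertices are adjacent in $\Gamma$), with the convention $\overline{\mathsf{CycHam}}(\mathsf{P}_1)=0$. -}

module Defs where

open import Level using (Level; _⊔_) renaming (suc to lsuc)
open import Data.Bool using (Bool; true; false; _∧_; not; if_then_else_; T)
open import Data.Nat using (ℕ; zero; suc; _⊓_; _≤_; _≟_)
open import Data.List using (List; []; _∷_; [_]; _++_; map; concat; concatMap; foldr;
  length; drop; take; upTo; zip; filter; filterᵇ)
open import Data.List.Properties using (≡-dec)
open import Data.Bool.ListAction using (any)
open import Data.List.Membership.Propositional using (_∈_; _∉_)
open import Data.List.Relation.Unary.All using (All)
open import Data.List.Relation.Unary.Unique.Propositional using (Unique)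
open import Data.List.Relation.Binary.Permutation.Propositional using (_↭_)
open import Data.Maybe using (Maybe; just; nothing)
open import Data.Product using (Σ; _×_; _,_; ∃; ∃₂; proj₁; proj₂)
open import Data.Sum using (_⊎_; inj₁; inj₂)
open import Relation.Nullary using (¬_; does)
open import Relation.Nullary.Decidable using (⌊_⌋)
open import Relation.Binary.PropositionalEquality using (_≡_; _≢_)
open import Algebra.Bundles using (CommutativeRing)

record Field (c ℓ : Level) : Set (lsuc (c ⊔ ℓ)) where
  field
    commRing : CommutativeRing c ℓ
  open CommutativeRing commRing public
  field
    1≉0     : ¬ (1# ≈ 0#)
    inverse : ∀ x → ¬ (x ≈ 0#) → Σ Carrier (λ y → (x * y) ≈ 1#)

-- Graphs.  Vertices are labelled by natural numbers; a (raw) graph is a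
-- list of vertex labels together with an adjacency test.  Only the values
-- of adj on vertices matter.

record Graph : Set where
  constructor mkGraph
  field
    V   : List ℕ
    adj : ℕ → ℕ → Bool
open Graph public

Simple : Graph → Set
Simple Γ = Unique (V Γ) × (∀ u v → adj Γ u v ≡ adj Γ v u) × (∀ v → adj Γ v v ≡ false)

data PathIn (Γ : Graph) (S : List ℕ) : ℕ → ℕ → Set where
  here  : ∀ {u} → PathIn Γ S u u
  step  : ∀ {u w v} → adj Γ u w ≡ true → w ∈ S → PathIn Γ S w v → PathIn Γ S u v

Tube : Graph → List ℕ → Set
Tube Γ S = (S ≢ []) × Unique S × (∀ x → x ∈ S → x ∈ V Γ)
         × (∀ u v → u ∈ S → v ∈ S → PathIn Γ S u v)

CGraph : Graph → Set
CGraph Γ = Simple Γ × Tube Γ (V Γ)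

GraphIso : Graph → Graph → (ℕ → ℕ) → Set
GraphIso Γ Γ' σ = (map σ (V Γ) ↭ V Γ')
  × (∀ u v → u ∈ V Γ → v ∈ V Γ → adj Γ' (σ u) (σ v) ≡ adj Γ u v)

-- Restriction and contraction.  The vertex {G} of a contracted graph is
-- labelled by the minimum of G.

minL : List ℕ → ℕ
minL []       = 0
minL (x ∷ xs) = foldr _⊓_ x xs

_==_ : ℕ → ℕ → Bool
m == n = does (m ≟ n)

_∈ᵇ_ : ℕ → List ℕ → Bool
x ∈ᵇ xs = any (_==_ x) xs

blockOf : List (List ℕ) → ℕ → Maybe (List ℕ)
blockOf []       a = nothing
blockOf (b ∷ bs) a = if minL b == a then just b else blockOf bs a

blockOrSelf : List (List ℕ) → ℕ → List ℕ
blockOrSelf I a with blockOf I a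
... | just b  = b
... | nothing = [ a ]

restrict : Graph → List ℕ → Graph
restrict Γ G = mkGraph G (adj Γ)

contractP : Graph → List (List ℕ) → Graph
contractP Γ I = mkGraph (map minL I) λ a b →
  not (a == b) ∧ any (λ u → any (λ w → adj Γ u w) (blockOrSelf I b)) (blockOrSelf I a)

contract : Graph → List ℕ → Graph
contract Γ G = contractP Γ (G ∷ map [_] (filterᵇ (λ v → not (v ∈ᵇ G)) (V Γ)))

substAt : ℕ → List ℕ → List ℕ → List ℕ
substAt m q s = concatMap (λ x → if x == m then q else [ x ]) s

-- substituting a sequence of Γ|_G for the vertex {G} of Γ/G
substTube : List ℕ → List ℕ → List ℕ → List ℕ
substTube G q s = substAt (minL G) q s

_==L_ : List ℕ → List ℕ → Bool
s ==L t = ⌊ ≡-dec _≟_ s t ⌋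

Rot : List ℕ → List ℕ → Set
Rot s t = ∃₂ λ a b → (s ≡ a ++ b) × (t ≡ b ++ a)

-- decidable version, used as equality of cyclic orderings
rotEq : List ℕ → List ℕ → Bool
rotEq s t = any (λ k → (drop k s ++ take k s) ==L t) (upTo (suc (length s)))

removeL : List ℕ → List (List ℕ) → Maybe (List (List ℕ))
removeL x []       = nothing
removeL x (y ∷ ys) with x ==L y
... | true  = just ys
... | false with removeL x ys
...   | just ys' = just (y ∷ ys')
...   | nothing  = nothing

isPermL : List (List ℕ) → List (List ℕ) → Bool
isPermL []       []      = true
isPermL []       (_ ∷ _) = false
isPermL (x ∷ xs) ys with removeL x ys
... | just ys' = isPermL xs ys'
... | nothing  = false

data PTree : Set where
  leaf : ℕ → PTree
  node : PTree → PTree → PTree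

leaves : PTree → List ℕ
leaves (leaf v)   = [ v ]
leaves (node l r) = leaves l ++ leaves r

Admissible : Graph → PTree → Set
Admissible Γ (leaf v)   = Tube Γ [ v ]
Admissible Γ (node l r) = Tube Γ (leaves l ++ leaves r) × Admissible Γ l × Admissible Γ r

PlanEqB : Graph → List ℕ → Set
PlanEqB Γ s = (s ↭ V Γ) × Σ PTree (λ t → Admissible Γ t × (leaves t ≡ s))

-- basis element of CycPerm(Γ) (representative of a cyclic ordering)
CycPermB : Graph → List ℕ → Set
CycPermB Γ s = s ↭ V Γ

CycEqB : Graph → List ℕ → Set
CycEqB Γ s = (s ↭ V Γ) × Σ (List ℕ) (λ r → Rot s r × PlanEqB Γ r)

cycPairs : List ℕ → List (ℕ × ℕ)
cycPairs []       = []
cycPairs (x ∷ xs) = zip (x ∷ xs) (xs ++ [ x ])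

-- directed Hamiltonian cycle of the complement of Γ; the condition
-- 2 ≤ length encodes the convention CycHam‾(P₁) = 0
HamB : Graph → List ℕ → Set
HamB Γ s = (s ↭ V Γ) × (2 ≤ length s)
         × All (λ p → adj Γ (proj₁ p) (proj₂ p) ≡ false) (cycPairs s)

-- Raw right PlanEq-modules with a basis: a raw type of basis
-- representatives, validity for each graph, a decidable equivalence of
-- representatives, relabelling along graph isomorphisms, and the action
-- x ∘_G p  (G the tube, p ∈ PlanEq(Γ|_G), x a basis element of Γ/G).

record BasedModule : Set₁ where
  field
    R       : Set
    valid   : Graph → R → Set
    eqv     : R → R → Bool
    relabel : (ℕ → ℕ) → R → R
    act     : List ℕ → List ℕ → R → R

CycPermM : BasedModule
CycPermM = record
  { R = List ℕ ; valid = CycPermB ; eqv = rotEq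
  ; relabel = map ; act = substTube }

CycEqM : BasedModule
CycEqM = record
  { R = List ℕ ; valid = CycEqB ; eqv = rotEq
  ; relabel = map ; act = substTube }

HamR : Set
HamR = List ℕ

-- A basis element is a partition I of
-- V_Γ into tubes, together with an element of PlanEq(Γ|_G) for each block
-- G (the block is the underlying set of that sequence) and a basis element
-- of W(Γ/I).  Blocks are unordered (equivalence up to permutation).
module FreeComp (WR : Set) (Wvalid : Graph → WR → Set) (Weqv : WR → WR → Bool)
                (Wrelabel : (ℕ → ℕ) → WR → WR) where

  CompR : Set
  CompR = List (List ℕ) × WR

  CompValid : Graph → CompR → Set
  CompValid Γ (bs , w) = (concat bs ↭ V Γ)
    × All (λ b → Tube Γ b × PlanEqB (restrict Γ b) b) bs
    × Wvalid (contractP Γ bs) w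

  CompEqv : CompR → CompR → Bool
  CompEqv (bs , w) (bs' , w') = isPermL bs bs' ∧ Weqv w w'

  -- the label minL b of a block is sent to the label of the image block
  blockRelabel : (ℕ → ℕ) → List (List ℕ) → ℕ → ℕ
  blockRelabel σ bs x with blockOf bs x
  ... | just b  = minL (map σ b)
  ... | nothing = σ x

  CompRelabel : (ℕ → ℕ) → CompR → CompR
  CompRelabel σ (bs , w) = (map (map σ) bs , Wrelabel (blockRelabel σ bs) w)

  CompAct : List ℕ → List ℕ → CompR → CompR
  CompAct H q (bs , w) = (map (substTube H q) bs , w)

  CompM : BasedModule
  CompM = record
    { R = CompR ; valid = CompValid ; eqv = CompEqv
    ; relabel = CompRelabel ; act = CompAct }

open FreeComp HamR HamB rotEq map public using (CompM)

HamCompM : BasedModule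
HamCompM = CompM

_⊕M_ : BasedModule → BasedModule → BasedModule
A ⊕M B = record
  { R = A.R ⊎ B.R
  ; valid = λ { Γ (inj₁ x) → A.valid Γ x ; Γ (inj₂ y) → B.valid Γ y }
  ; eqv = λ { (inj₁ x) (inj₁ x') → A.eqv x x' ; (inj₂ y) (inj₂ y') → B.eqv y y'
            ; _ _ → false }
  ; relabel = λ { σ (inj₁ x) → inj₁ (A.relabel σ x) ; σ (inj₂ y) → inj₂ (B.relabel σ y) }
  ; act = λ { G q (inj₁ x) → inj₁ (A.act G q x) ; G q (inj₂ y) → inj₂ (B.act G q y) }
  }
  where
  module A = BasedModule A
  module B = BasedModule B

-- Linear algebra: the k-vector space with basis (the equivalence classes
-- of) valid representatives, vectors as finite formal linear combinations.

module Lin {c ℓ : Level} (K : Field c ℓ) where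
  open Field K

  FVec : Set → Set c
  FVec R = List (Carrier × R)

  coeff : {R : Set} → (R → R → Bool) → FVec R → R → Carrier
  coeff e []            r = 0#
  coeff e ((a , x) ∷ v) r = if e x r then a + coeff e v r else coeff e v r

  VecEq : (M : BasedModule) → FVec (BasedModule.R M) → FVec (BasedModule.R M) → Set ℓ
  VecEq M v w = ∀ r → coeff (BasedModule.eqv M) v r ≈ coeff (BasedModule.eqv M) w r

  ValidVec : (M : BasedModule) → Graph → FVec (BasedModule.R M) → Set c
  ValidVec M Γ v = All (λ p → BasedModule.valid M Γ (proj₂ p)) v

  basisVec : {R : Set} → R → FVec R
  basisVec x = [ (1# , x) ]

  extend : {R S : Set} → (R → FVec S) → FVec R → FVec S
  extend f v = concatMap (λ p → map (λ q → (proj₁ p * proj₁ q , proj₂ q)) (f (proj₂ p))) v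

  mapVec : {R S : Set} → (R → S) → FVec R → FVec S
  mapVec g v = map (λ p → (proj₁ p , g (proj₂ p))) v

  IsModuleIso : (A B : BasedModule)
    → ((Γ : Graph) → BasedModule.R A → FVec (BasedModule.R B))
    → ((Γ : Graph) → BasedModule.R B → FVec (BasedModule.R A))
    → Set (c ⊔ ℓ)
  IsModuleIso A B f g =
    -- well defined on basis elements
      (∀ Γ → CGraph Γ → ∀ x → A.valid Γ x → ValidVec B Γ (f Γ x))
    × (∀ Γ → CGraph Γ → ∀ y → B.valid Γ y → ValidVec A Γ (g Γ y))
    × (∀ Γ → CGraph Γ → ∀ x x' → A.valid Γ x → A.valid Γ x' → T (A.eqv x x')
         → VecEq B (f Γ x) (f Γ x'))
    × (∀ Γ → CGraph Γ → ∀ y y' → B.valid Γ y → B.valid Γ y' → T (B.eqv y y')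
         → VecEq A (g Γ y) (g Γ y'))
    × (∀ Γ → CGraph Γ → ∀ x → A.valid Γ x → VecEq A (extend (g Γ) (f Γ x)) (basisVec x))
    × (∀ Γ → CGraph Γ → ∀ y → B.valid Γ y → VecEq B (extend (f Γ) (g Γ y)) (basisVec y))
    -- morphism of collections (natural in graph isomorphisms)
    × (∀ Γ Γ' σ → CGraph Γ → CGraph Γ' → GraphIso Γ Γ' σ → ∀ x → A.valid Γ x
         → VecEq B (f Γ' (A.relabel σ x)) (mapVec (B.relabel σ) (f Γ x)))
    -- compatible with the right PlanEq-action
    × (∀ Γ G → CGraph Γ → Tube Γ G → ∀ x p → A.valid (contract Γ G) x
         → PlanEqB (restrict Γ G) p
         → VecEq B (f Γ (A.act G p x)) (mapVec (B.act G p) (f (contract Γ G) x)))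
    where
    module A = BasedModule A
    module B = BasedModule B

{-# OPTIONS --safe #-}

-- A cyclic ordering x of V_Γ is decomposed by greedy merging: starting from its letters as
-- one-leaf trees, two cyclically consecutive admissible trees whose leaf sets are joined by an
-- edge are replaced by the tree with these two subtrees, until no consecutive trees are adjacent.
-- If one tree remains, a rotation of x lies in PlanEq and x is a basis element of CycEq.
-- Otherwise the leaf sets are at least two tubes, planarly ordered, with no edge between
-- cyclically consecutive ones: a partition I into tubes together with a Hamiltonian cycle of
-- the complement of Γ/I, that is, a basis element of CycHam‾ ∘ PlanEq; concatenation inverts this.
-- The outcome depends only on the cyclic ordering: an admissible tree whose leaves form a cyclic
-- interval of such a cycle of blocks lies inside one block, since no edge joins consecutive
-- blocks. Hence a cycle of blocks is never a rotation of a planar ordering, and its blocks are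
-- recovered as the maximal runs of letters sharing a block. Relabelling and substituting a planar
-- sequence for a contracted tube commute with the merging, and substitution keeps consecutive
-- blocks nonadjacent, which gives naturality and compatibility with the PlanEq-action.

module Submission where

open import Defs
open import Level using (Level)
open import Function.Base using (case_of_)
open import Function.Bundles using (Equivalence)
open import Data.Empty using (⊥; ⊥-elim)
open import Data.Bool using (Bool; true; false; _∧_; _∨_; not; if_then_else_; T)
open import Data.Bool.Properties using (T-≡; ∧-zeroʳ)
open import Data.Bool.ListAction using (any)
open import Data.Nat using (ℕ; zero; suc; _≤_; _⊓_; _≟_; s≤s; z≤n)
open import Data.Nat.Properties using (≡ᵇ⇒≡; m⊓n≤m; m⊓n≤n; ⊓-sel; ≤-antisym; ≤-trans; ≤-refl; ≤-pred; n≤1+n)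
open import Data.Product using (Σ; _×_; _,_; ∃; ∃₂; proj₁; proj₂)
open import Data.Sum using (_⊎_; inj₁; inj₂; [_,_]′) renaming (map to ⊎-map)
open import Data.Maybe using (Maybe; just; nothing)
import Data.Maybe as Maybe
open import Data.List using (List; []; _∷_; [_]; _++_; map; concat; foldr; length; drop; take; upTo; zip; filterᵇ)
open import Data.List.Properties
  using (++-assoc; ++-identityʳ; map-++; concat-++; ∷-injective; ∷ʳ-injective; take++drop≡id; length-++-≤ˡ;
         length-map; map-∘; map-id; map-cong-local; foldr-++; concatMap-++; ≡-dec)
open import Data.List.Membership.Propositional using (_∈_; _∉_)
open import Data.List.Membership.Propositional.Properties
  using (∈-++⁺ˡ; ∈-++⁺ʳ; ∈-++⁻; ∈-map⁺; ∈-map⁻; ∈-concat⁺′; ∈-concat⁻′; ∈-upTo⁺; ∈-∃++)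
open import Data.List.Relation.Unary.Any using (here; there)
open import Data.List.Relation.Unary.All as All using (All; []; _∷_)
open import Data.List.Relation.Unary.All.Properties using () renaming (++⁻ to All-++⁻; map⁺ to All-map⁺)
open import Data.List.Relation.Unary.AllPairs using ([]; _∷_)
open import Data.List.Relation.Unary.Unique.Propositional using (Unique)
open import Data.List.Relation.Unary.Unique.Propositional.Properties using () renaming (++⁺ to Unique-++⁺)
open import Data.List.Relation.Binary.Permutation.Propositional
  using (_↭_; refl; prep; swap; trans; ↭-sym; ↭-refl; ↭-trans)
open import Data.List.Relation.Binary.Permutation.Propositional.Properties
  using (All-resp-↭; ∈-resp-↭; ++-comm; ++⁺ˡ; shifts; drop-∷; ↭-empty-inv; ↭-length; map⁺)
open import Relation.Nullary using (¬_; yes; no)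
open import Relation.Nullary.Decidable using (dec-true; dec-false)
open import Relation.Binary.PropositionalEquality
  using (_≡_; _≢_; refl; sym; cong; cong₂; subst; subst₂; module ≡-Reasoning)
  renaming (trans to ≡trans)

private
  variable
    A B : Set

≡true⇔⇒≡ : {a b : Bool} → (a ≡ true → b ≡ true) → (b ≡ true → a ≡ true) → a ≡ b
≡true⇔⇒≡ {true}  {true}  f g = refl
≡true⇔⇒≡ {true}  {false} f g = sym (f refl)
≡true⇔⇒≡ {false} {true}  f g = g refl
≡true⇔⇒≡ {false} {false} f g = refl

≢true⇒≡false : {a : Bool} → ¬ (a ≡ true) → a ≡ false
≢true⇒≡false {true}  h = ⊥-elim (h refl)
≢true⇒≡false {false} h = refl

not≡true⇒≢true : {b : Bool} → not b ≡ true → b ≢ true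
not≡true⇒≢true {true}  () _
not≡true⇒≢true {false} _  ()

∧≡true⁻ : {a b : Bool} → (a ∧ b) ≡ true → (a ≡ true) × (b ≡ true)
∧≡true⁻ {true} {true} _ = refl , refl

∧≡true⁺ : {a b : Bool} → a ≡ true → b ≡ true → (a ∧ b) ≡ true
∧≡true⁺ refl refl = refl

any≡true⁻ : (p : A → Bool) (xs : List A) → any p xs ≡ true → ∃ λ x → x ∈ xs × p x ≡ true
any≡true⁻ p (x ∷ xs) e with p x in eq
... | true  = x , here refl , eq
... | false with any≡true⁻ p xs e
... | y , m , q = y , there m , q

any≡true⁺ : (p : A → Bool) {xs : List A} {x : A} → x ∈ xs → p x ≡ true → any p xs ≡ true
any≡true⁺ p {x ∷ xs} (here refl) e rewrite e = refl
any≡true⁺ p {x ∷ xs} (there m) e with p x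
... | true  = refl
... | false = any≡true⁺ p m e

any≡false⁻ : (p : A → Bool) {xs : List A} {x : A} → any p xs ≡ false → x ∈ xs → p x ≡ false
any≡false⁻ p e m = ≢true⇒≡false λ px → case ≡trans (sym e) (any≡true⁺ p m px) of λ ()

any≡false⁺ : (p : A → Bool) (xs : List A) → (∀ x → x ∈ xs → p x ≡ false) → any p xs ≡ false
any≡false⁺ p []       h = refl
any≡false⁺ p (x ∷ xs) h rewrite h x (here refl) = any≡false⁺ p xs (λ y m → h y (there m))

==-refl : (n : ℕ) → (n == n) ≡ true
==-refl n = dec-true (n ≟ n) refl

==-ne : {m n : ℕ} → m ≢ n → (m == n) ≡ false
==-ne {m} {n} = dec-false (m ≟ n)

==-sound : {m n : ℕ} → (m == n) ≡ true → m ≡ n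
==-sound {m} {n} e = ≡ᵇ⇒≡ m n (Equivalence.from T-≡ e)

==-false : {m n : ℕ} → (m == n) ≡ false → m ≢ n
==-false {m} {n} e m≡n with () ← ≡trans (sym e) (dec-true (m ≟ n) m≡n)

==-sym : (m n : ℕ) → (m == n) ≡ (n == m)
==-sym m n = ≡true⇔⇒≡ (λ e → dec-true (n ≟ m) (sym (==-sound e))) (λ e → dec-true (m ≟ n) (sym (==-sound e)))

==L-refl : (s : List ℕ) → (s ==L s) ≡ true
==L-refl s with ≡-dec _≟_ s s
... | yes _   = refl
... | no s≢s = ⊥-elim (s≢s refl)

==L-sound : {s t : List ℕ} → (s ==L t) ≡ true → s ≡ t
==L-sound {s} {t} e with ≡-dec _≟_ s t
... | yes s≡t = s≡t

∈⇒∈ᵇ : {x : ℕ} {D : List ℕ} → x ∈ D → (x ∈ᵇ D) ≡ true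
∈⇒∈ᵇ {x} m = any≡true⁺ (x ==_) m (==-refl x)

∈ᵇ⇒∈ : {x : ℕ} {D : List ℕ} → (x ∈ᵇ D) ≡ true → x ∈ D
∈ᵇ⇒∈ {x} {D} e with any≡true⁻ (x ==_) D e
... | y , m , q = subst (_∈ D) (sym (==-sound q)) m


++≡++-split : (b a c d : List A) → b ++ a ≡ c ++ d
  → (∃ λ e → b ≡ c ++ e × d ≡ e ++ a) ⊎ (∃ λ e → c ≡ b ++ e × a ≡ e ++ d)
++≡++-split []      a c       d eq = inj₂ (c , refl , eq)
++≡++-split (x ∷ b) a []      d eq = inj₁ (x ∷ b , refl , sym eq)
++≡++-split (x ∷ b) a (y ∷ c) d eq with ∷-injective eq
... | refl , eq' with ++≡++-split b a c d eq'
... | inj₁ (e , p , q) = inj₁ (e , cong (x ∷_) p , q)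
... | inj₂ (e , p , q) = inj₂ (e , cong (x ∷_) p , q)

drop-length-++ : (a b : List A) → drop (length a) (a ++ b) ≡ b
drop-length-++ []      b = refl
drop-length-++ (x ∷ a) b = drop-length-++ a b

take-length-++ : (a b : List A) → take (length a) (a ++ b) ≡ a
take-length-++ []      b = refl
take-length-++ (x ∷ a) b = cong (x ∷_) (take-length-++ a b)

NonEmpty : List A → Set
NonEmpty xs = xs ≢ []

∈⇒nonEmpty : {xs : List A} {x : A} → x ∈ xs → NonEmpty xs
∈⇒nonEmpty (here _)  ()
∈⇒nonEmpty (there _) ()

nonEmpty-element : {xs : List A} → NonEmpty xs → ∃ λ x → x ∈ xs
nonEmpty-element {xs = []}    ne = ⊥-elim (ne refl)
nonEmpty-element {xs = x ∷ _} ne = x , here refl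

++-nonEmpty : {xs ys : List A} → NonEmpty xs → NonEmpty (xs ++ ys)
++-nonEmpty {xs = []}    ne = λ _ → ne refl
++-nonEmpty {xs = x ∷ _} ne = λ ()

∷ʳ-nonEmpty : (m : List A) {a : A} → NonEmpty (m ++ [ a ])
∷ʳ-nonEmpty []      ()
∷ʳ-nonEmpty (_ ∷ _) ()

↭-nonEmpty : {x y : List A} → x ↭ y → NonEmpty y → NonEmpty x
↭-nonEmpty p ne refl = ne (↭-empty-inv (↭-sym p))

∈-middle : (P : List A) {D : A} {Q : List A} → D ∈ P ++ D ∷ Q
∈-middle P = ∈-++⁺ʳ P (here refl)

∃-init-last : {xs : List A} → NonEmpty xs → ∃₂ λ ys u → xs ≡ ys ++ [ u ]
∃-init-last {xs = []}         ne = ⊥-elim (ne refl)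
∃-init-last {xs = x ∷ []}     ne = [] , x , refl
∃-init-last {xs = x ∷ y ∷ xs} ne with ∃-init-last {xs = y ∷ xs} (λ ())
... | ys , u , e = x ∷ ys , u , cong (x ∷_) e

head-∈ : {D rest : List A} {v : A} {q : List A} → NonEmpty D → D ++ rest ≡ v ∷ q → v ∈ D
head-∈ {D = []}    ne e = ⊥-elim (ne refl)
head-∈ {D = x ∷ D} ne e with ∷-injective e
... | refl , _ = here refl

last-∈ : (X : List A) {D Y : List A} {u : A} → NonEmpty D → X ++ D ≡ Y ++ [ u ] → u ∈ D
last-∈ X {D} {Y} {u} ne e with ++≡++-split X D Y [ u ] e
... | inj₁ ([] , _ , q) = subst (u ∈_) q (here refl)
... | inj₁ (w ∷ [] , _ , q) with ∷-injective q
...   | _ , q2 = ⊥-elim (ne (sym q2))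
last-∈ X {D} {Y} {u} ne e | inj₁ (w ∷ w' ∷ e' , _ , ())
last-∈ X {D} {Y} {u} ne e | inj₂ (w , _ , q) = subst (u ∈_) (sym q) (∈-++⁺ʳ w (here refl))

map-cong-∈ : {f g : A → B} (xs : List A) → (∀ x → x ∈ xs → f x ≡ g x) → map f xs ≡ map g xs
map-cong-∈ xs h = map-cong-local (All.tabulate (h _))

map-consecutive : (f : A → B) (L : List A) (P : List B) {a b : B} {Q : List B} → map f L ≡ P ++ a ∷ b ∷ Q
  → ∃₂ λ P' Q' → ∃₂ λ x y → L ≡ P' ++ x ∷ y ∷ Q' × f x ≡ a × f y ≡ b
map-consecutive f (x ∷ y ∷ L) [] e with ∷-injective e
... | e1 , e2 with ∷-injective e2
... | e3 , _ = [] , L , x , y , refl , e1 , e3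
map-consecutive f (x ∷ L) (p ∷ P) e with map-consecutive f L P (proj₂ (∷-injective e))
... | P' , Q' , u , v , eq , e1 , e2 = x ∷ P' , Q' , u , v , cong (x ∷_) eq , e1 , e2
map-consecutive f [] [] ()
map-consecutive f (x ∷ []) [] ()
map-consecutive f [] (p ∷ P) ()

map-∷ʳ : (f : A → B) (L : List A) (m : List B) {a : B} → NonEmpty L → map f L ≡ m ++ [ a ]
  → ∃₂ λ m' x → L ≡ m' ++ [ x ] × f x ≡ a
map-∷ʳ f [] m ne e = ⊥-elim (ne refl)
map-∷ʳ f (x ∷ []) [] ne e = [] , x , refl , proj₁ (∷-injective e)
map-∷ʳ f (x ∷ []) (_ ∷ []) ne ()
map-∷ʳ f (x ∷ []) (_ ∷ _ ∷ _) ne ()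
map-∷ʳ f (x ∷ y ∷ L) [] ne ()
map-∷ʳ f (x ∷ y ∷ L) (p ∷ m) ne e with map-∷ʳ f (y ∷ L) m (λ ()) (proj₂ (∷-injective e))
... | m' , z , eq , ez = x ∷ m' , z , cong (x ∷_) eq , ez

map-wrap : (F : A → B) (w : List A) {B₁ B' : B} {m : List B} → map F w ≡ B' ∷ m ++ [ B₁ ]
  → ∃₂ λ x xs → ∃₂ λ m' a → w ≡ x ∷ xs × xs ≡ m' ++ [ a ] × F x ≡ B' × F a ≡ B₁
map-wrap F (x ∷ xs) {m = m} e with ∷-injective e
... | e1 , e2 with xs
... | [] = ⊥-elim (∷ʳ-nonEmpty m (sym e2))
... | y ∷ ys with map-∷ʳ F (y ∷ ys) m (λ ()) e2
... | m' , a , eq , ea = x , y ∷ ys , m' , a , refl , eq , e1 , ea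

zip-All : {P : A × A → Set} (x : A) (xs : List A) (y : A)
  → (∀ P' a b Q → x ∷ xs ≡ P' ++ a ∷ b ∷ Q → P (a , b))
  → (∀ m a → x ∷ xs ≡ m ++ [ a ] → P (a , y))
  → All P (zip (x ∷ xs) (xs ++ [ y ]))
zip-All x [] y h1 h2 = h2 [] x refl ∷ []
zip-All x (x' ∷ xs) y h1 h2 = h1 [] x x' xs refl ∷
  zip-All x' xs y (λ P' a b Q e → h1 (x ∷ P') a b Q (cong (x ∷_) e)) (λ m a e → h2 (x ∷ m) a (cong (x ∷_) e))

zip-consecutive : (x : A) (xs : List A) (y : A) (P' : List A) {a b : A} {Q : List A} → x ∷ xs ≡ P' ++ a ∷ b ∷ Q
  → (a , b) ∈ zip (x ∷ xs) (xs ++ [ y ])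
zip-consecutive x (x' ∷ xs) y [] e with ∷-injective e
... | refl , e2 with ∷-injective e2
... | refl , _ = here refl
zip-consecutive x (x' ∷ xs) y (p ∷ P') e = there (zip-consecutive x' xs y P' (proj₂ (∷-injective e)))
zip-consecutive x [] y [] ()
zip-consecutive x [] y (p ∷ []) ()
zip-consecutive x [] y (p ∷ _ ∷ _) ()

zip-wrap : (x : A) (xs : List A) (y : A) (m : List A) {a : A} → x ∷ xs ≡ m ++ [ a ]
  → (a , y) ∈ zip (x ∷ xs) (xs ++ [ y ])
zip-wrap x [] y [] e with ∷-injective e
... | refl , _ = here refl
zip-wrap x [] y (p ∷ []) ()
zip-wrap x [] y (p ∷ _ ∷ _) ()
zip-wrap x (x' ∷ xs) y [] ()
zip-wrap x (x' ∷ xs) y (p ∷ m) e = there (zip-wrap x' xs y m (proj₂ (∷-injective e)))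

cycPairs-consecutive : (w P : List ℕ) {a b : ℕ} {Q : List ℕ} → w ≡ P ++ a ∷ b ∷ Q → (a , b) ∈ cycPairs w
cycPairs-consecutive (x ∷ xs) P e = zip-consecutive x xs x P e
cycPairs-consecutive [] [] ()
cycPairs-consecutive [] (_ ∷ _) ()

cycPairs-wrap : (x : ℕ) (xs m : List ℕ) {a : ℕ} → xs ≡ m ++ [ a ] → (a , x) ∈ cycPairs (x ∷ xs)
cycPairs-wrap x xs m e = zip-wrap x xs x (x ∷ m) (cong (x ∷_) e)

concat-↭ : {xs ys : List (List A)} → xs ↭ ys → concat xs ↭ concat ys
concat-↭ refl        = ↭-refl
concat-↭ (prep x p)  = ++⁺ˡ x (concat-↭ p)
concat-↭ {xs = x ∷ y ∷ xs} (swap x y p) = ↭-trans (shifts x y) (++⁺ˡ y (++⁺ˡ x (concat-↭ p)))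
concat-↭ (trans p q) = ↭-trans (concat-↭ p) (concat-↭ q)

unique-resp-↭ : {xs ys : List A} → xs ↭ ys → Unique xs → Unique ys
unique-resp-↭ refl u = u
unique-resp-↭ (prep x p) (a ∷ u) = All-resp-↭ p a ∷ unique-resp-↭ p u
unique-resp-↭ (swap x y p) ((x≢y ∷ ax) ∷ (ay ∷ u)) =
  ((λ e → x≢y (sym e)) ∷ All-resp-↭ p ay) ∷ (All-resp-↭ p ax ∷ unique-resp-↭ p u)
unique-resp-↭ (trans p q) u = unique-resp-↭ q (unique-resp-↭ p u)

unique-++ˡ : {xs ys : List A} → Unique (xs ++ ys) → Unique xs
unique-++ˡ {xs = []}     u       = []
unique-++ˡ {xs = x ∷ xs} (a ∷ u) = proj₁ (All-++⁻ xs a) ∷ unique-++ˡ u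

unique-++ʳ : (xs : List A) {ys : List A} → Unique (xs ++ ys) → Unique ys
unique-++ʳ []       u       = u
unique-++ʳ (x ∷ xs) (a ∷ u) = unique-++ʳ xs u

unique-++-disjoint : (xs : List A) {ys : List A} {z : A} → Unique (xs ++ ys) → z ∈ xs → z ∈ ys → ⊥
unique-++-disjoint (x ∷ xs) (a ∷ u) (here refl) m₂ = All.lookup (proj₂ (All-++⁻ xs a)) m₂ refl
unique-++-disjoint (x ∷ xs) (a ∷ u) (there m₁) m₂ = unique-++-disjoint xs u m₁ m₂

unique-consecutive-≢ : (P : List A) {a b : A} {Q : List A} → Unique (P ++ a ∷ b ∷ Q) → a ≢ b
unique-consecutive-≢ [] ((h ∷ _) ∷ _) = h
unique-consecutive-≢ (p ∷ P) (_ ∷ u) = unique-consecutive-≢ P u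

unique-wrap-≢ : (x : A) (m : List A) {a : A} → Unique (x ∷ m ++ [ a ]) → a ≢ x
unique-wrap-≢ x m (h ∷ _) e = All.lookup h (∈-++⁺ʳ m (here (sym e))) refl

concat-consecutive-disjoint : (P : List (List A)) {D D' : List A} {Q : List (List A)}
  → Unique (concat (P ++ D ∷ D' ∷ Q)) → ∀ z → z ∈ D → z ∈ D' → ⊥
concat-consecutive-disjoint P {D} {D'} {Q} u z z∈D z∈D' =
  unique-++-disjoint D (unique-++ʳ (concat P) (subst Unique (sym (concat-++ P (D ∷ D' ∷ Q))) u)) z∈D (∈-++⁺ˡ z∈D')

concat-wrap-disjoint : {D D' : List A} (m : List (List A))
  → Unique (concat (D' ∷ m ++ [ D ])) → ∀ z → z ∈ D → z ∈ D' → ⊥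
concat-wrap-disjoint m u z z∈D z∈D' = unique-++-disjoint _ u z∈D' (∈-concat⁺′ z∈D (∈-++⁺ʳ m (here refl)))

same-block : {ds : List (List A)} {D₁ D₂ : List A} {x : A} → Unique (concat ds)
  → D₁ ∈ ds → D₂ ∈ ds → x ∈ D₁ → x ∈ D₂ → D₁ ≡ D₂
same-block {ds = E ∷ es} u (here refl) (here refl) m₁ m₂ = refl
same-block {ds = E ∷ es} u (here refl) (there d₂) m₁ m₂ = ⊥-elim (unique-++-disjoint E u m₁ (∈-concat⁺′ m₂ d₂))
same-block {ds = E ∷ es} u (there d₁) (here refl) m₁ m₂ = ⊥-elim (unique-++-disjoint E u m₂ (∈-concat⁺′ m₁ d₁))
same-block {ds = E ∷ es} u (there d₁) (there d₂) m₁ m₂ = same-block (unique-++ʳ E u) d₁ d₂ m₁ m₂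

∈-filterᵇ⁻ : (q : A → Bool) (L : List A) {v : A} → v ∈ filterᵇ q L → v ∈ L × q v ≡ true
∈-filterᵇ⁻ q (y ∷ L) m with q y in e
∈-filterᵇ⁻ q (y ∷ L) (here refl) | true = here refl , e
∈-filterᵇ⁻ q (y ∷ L) (there m) | true = there (proj₁ (∈-filterᵇ⁻ q L m)) , proj₂ (∈-filterᵇ⁻ q L m)
∈-filterᵇ⁻ q (y ∷ L) m | false = there (proj₁ (∈-filterᵇ⁻ q L m)) , proj₂ (∈-filterᵇ⁻ q L m)

filterᵇ-unique : (q : A → Bool) (L : List A) → Unique L → Unique (filterᵇ q L)
filterᵇ-unique q [] u = []
filterᵇ-unique q (y ∷ L) (a ∷ u) with q y in e
... | true = All.tabulate (λ m → All.lookup a (proj₁ (∈-filterᵇ⁻ q L m))) ∷ filterᵇ-unique q L u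
... | false = filterᵇ-unique q L u


-- Rot at an arbitrary element type; at ℕ it is Rot itself, definitionally.
Rot′ : List A → List A → Set
Rot′ {A} s t = Σ (List A) λ a → Σ (List A) λ b → (s ≡ a ++ b) × (t ≡ b ++ a)

rot-refl : (s : List A) → Rot′ s s
rot-refl s = [] , s , refl , sym (++-identityʳ s)

rot-sym : {s t : List A} → Rot′ s t → Rot′ t s
rot-sym (a , b , p , q) = b , a , q , p

rot-trans : {s t u : List A} → Rot′ s t → Rot′ t u → Rot′ s u
rot-trans (a , b , sp , tp) (c , d , tq , uq) with ++≡++-split b a c d (≡trans (sym tp) tq)
... | inj₁ (e , p , q) = a ++ c , e ,
        ≡trans sp (≡trans (cong (a ++_) p) (sym (++-assoc a c e))) ,
        ≡trans uq (≡trans (cong (_++ c) q) (++-assoc e a c))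
... | inj₂ (e , p , q) = e , d ++ b ,
        ≡trans sp (≡trans (cong (_++ b) q) (++-assoc e d b)) ,
        ≡trans uq (≡trans (cong (d ++_) p) (sym (++-assoc d b e)))

rot⇒↭ : {s t : List A} → Rot′ s t → s ↭ t
rot⇒↭ (a , b , refl , refl) = ++-comm a b

rot-map : (f : A → B) {s t : List A} → Rot′ s t → Rot′ (map f s) (map f t)
rot-map f (a , b , refl , refl) = map f a , map f b , map-++ f a b , map-++ f b a

rot-concat : {s t : List (List A)} → Rot′ s t → Rot′ (concat s) (concat t)
rot-concat (a , b , refl , refl) = concat a , concat b , sym (concat-++ a b) , sym (concat-++ b a)

rot-[] : {x : List A} → Rot′ x [] → x ≡ []
rot-[] ([] , [] , refl , _) = refl
rot-[] ([] , _ ∷ _ , _ , ())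
rot-[] (_ ∷ _ , [] , _ , ())
rot-[] (_ ∷ _ , _ ∷ _ , _ , ())

rotEq-sound : {s t : List ℕ} → rotEq s t ≡ true → Rot s t
rotEq-sound {s} {t} e with any≡true⁻ _ (upTo (suc (length s))) e
... | k , _ , q = take k s , drop k s , sym (take++drop≡id k s) , sym (==L-sound q)

rotEq-complete : {s t : List ℕ} → Rot s t → rotEq s t ≡ true
rotEq-complete (a , b , refl , refl) =
  any≡true⁺ _ (∈-upTo⁺ (s≤s (length-++-≤ˡ a)))
    (subst (λ z → (z ==L (b ++ a)) ≡ true)
       (sym (cong₂ _++_ (drop-length-++ a b) (take-length-++ a b))) (==L-refl (b ++ a)))

rotEq-refl : (s : List ℕ) → rotEq s s ≡ true
rotEq-refl s = rotEq-complete (rot-refl s)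

rotEq-coh : {s s' : List ℕ} → rotEq s s' ≡ true → (r : List ℕ) → rotEq s r ≡ rotEq s' r
rotEq-coh {s} {s'} e r = ≡true⇔⇒≡
  (λ e₁ → rotEq-complete (rot-trans (rot-sym (rotEq-sound {s} {s'} e)) (rotEq-sound {s} {r} e₁)))
  (λ e₂ → rotEq-complete (rot-trans (rotEq-sound {s} {s'} e) (rotEq-sound {s'} {r} e₂)))

CyclicInfix : List A → List A → Set
CyclicInfix {A} c xs = Σ (List A) λ q → Rot′ c (xs ++ q)

cyclicInfix-++ˡ : {c : List A} (L R : List A) → CyclicInfix c (L ++ R) → CyclicInfix c L
cyclicInfix-++ˡ L R (q , r) = R ++ q , subst (Rot′ _) (++-assoc L R q) r

cyclicInfix-++ʳ : {c : List A} (L R : List A) → CyclicInfix c (L ++ R) → CyclicInfix c R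
cyclicInfix-++ʳ L R (q , r) = q ++ L , rot-trans r (L , R ++ q , ++-assoc L R q , sym (++-assoc R q L))

cyclicInfix-junction : {c : List A} (L R : List A) → NonEmpty L → NonEmpty R → CyclicInfix c (L ++ R)
  → ∃₂ λ u v → ∃ λ q → Rot′ c (u ∷ v ∷ q) × u ∈ L × v ∈ R
cyclicInfix-junction L [] _ ne _ = ⊥-elim (ne refl)
cyclicInfix-junction L (v ∷ R0) ne _ (q , r) with ∃-init-last ne
... | L0 , u , refl = u , v , R0 ++ q ++ L0 ,
   rot-trans r (L0 , u ∷ v ∷ R0 ++ q ,
     ≡trans (++-assoc (L0 ++ [ u ]) (v ∷ R0) q) (++-assoc L0 [ u ] (v ∷ R0 ++ q)) ,
     cong (λ z → u ∷ v ∷ z) (sym (++-assoc R0 q L0))) ,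
   ∈-++⁺ʳ L0 (here refl) , here refl


removeL-sound : (x : List ℕ) (ys : List (List ℕ)) {ys' : List (List ℕ)} → removeL x ys ≡ just ys' → ys ↭ x ∷ ys'
removeL-sound x (y ∷ ys) e with x ==L y in eq
... | true with e
... | refl rewrite ==L-sound eq = ↭-refl
removeL-sound x (y ∷ ys) e | false with removeL x ys in eq2
removeL-sound x (y ∷ ys) refl | false | just ys'' =
  ↭-trans (prep y (removeL-sound x ys eq2)) (swap y x ↭-refl)

removeL-complete : (x : List ℕ) (ys : List (List ℕ)) → x ∈ ys → ∃ λ ys' → removeL x ys ≡ just ys'
removeL-complete x (y ∷ ys) m with x ==L y in eq
... | true = ys , refl
... | false with removeL x ys in eq2
... | just ys' = y ∷ ys' , refl
... | nothing with m
... | here refl with ≡trans (sym eq) (==L-refl x)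
... | ()
removeL-complete x (y ∷ ys) m | false | nothing | there m' with removeL-complete x ys m'
... | _ , e with ≡trans (sym eq2) e
... | ()

isPermL-sound : (xs ys : List (List ℕ)) → isPermL xs ys ≡ true → xs ↭ ys
isPermL-sound [] [] e = ↭-refl
isPermL-sound (x ∷ xs) ys e with removeL x ys in eq
... | just ys' = ↭-trans (prep x (isPermL-sound xs ys' e)) (↭-sym (removeL-sound x ys eq))

isPermL-complete : (xs ys : List (List ℕ)) → xs ↭ ys → isPermL xs ys ≡ true
isPermL-complete [] [] p = refl
isPermL-complete [] (y ∷ ys) p with ↭-empty-inv (↭-sym p)
... | ()
isPermL-complete (x ∷ xs) ys p with removeL-complete x ys (∈-resp-↭ p (here refl))
... | ys' , e rewrite e =
  isPermL-complete xs ys' (drop-∷ (↭-trans p (removeL-sound x ys e)))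

isPermL-coh : {s s' : List (List ℕ)} → isPermL s s' ≡ true → (r : List (List ℕ)) → isPermL s r ≡ isPermL s' r
isPermL-coh {s} {s'} e r = ≡true⇔⇒≡
  (λ e1 → isPermL-complete s' r (↭-trans (↭-sym (isPermL-sound s s' e)) (isPermL-sound s r e1)))
  (λ e2 → isPermL-complete s r (↭-trans (isPermL-sound s s' e) (isPermL-sound s' r e2)))


foldmin-∈ : (x : ℕ) (xs : List ℕ) → foldr _⊓_ x xs ∈ (x ∷ xs)
foldmin-∈ x [] = here refl
foldmin-∈ x (y ∷ xs) with ⊓-sel y (foldr _⊓_ x xs)
... | inj₁ e rewrite e = there (here refl)
... | inj₂ e rewrite e with foldmin-∈ x xs
... | here p = here p
... | there p = there (there p)

foldmin-≤ : (x : ℕ) (xs : List ℕ) {y : ℕ} → y ∈ (x ∷ xs) → foldr _⊓_ x xs ≤ y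
foldmin-≤ x [] (here refl) = ≤-refl
foldmin-≤ x (z ∷ xs) (here refl) = ≤-trans (m⊓n≤n z _) (foldmin-≤ x xs (here refl))
foldmin-≤ x (z ∷ xs) (there (here refl)) = m⊓n≤m z _
foldmin-≤ x (z ∷ xs) (there (there m)) = ≤-trans (m⊓n≤n z _) (foldmin-≤ x xs (there m))

minL-∈ : {xs : List ℕ} → NonEmpty xs → minL xs ∈ xs
minL-∈ {[]} ne = ⊥-elim (ne refl)
minL-∈ {x ∷ xs} ne = foldmin-∈ x xs

minL-≤ : {xs : List ℕ} {y : ℕ} → y ∈ xs → minL xs ≤ y
minL-≤ {x ∷ xs} m = foldmin-≤ x xs m

minL-char : {xs : List ℕ} {m : ℕ} → m ∈ xs → (∀ y → y ∈ xs → m ≤ y) → minL xs ≡ m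
minL-char {xs} mm h = ≤-antisym (minL-≤ mm) (h _ (minL-∈ (∈⇒nonEmpty mm)))

minL-blocks-unique : (bs : List (List ℕ)) → All NonEmpty bs → Unique (concat bs) → Unique (map minL bs)
minL-blocks-unique [] _ _ = []
minL-blocks-unique (C ∷ cs) (neC ∷ ne) u =
  All.tabulate (λ {y} my → helper my) ∷ minL-blocks-unique cs ne (unique-++ʳ C u)
  where
  helper : ∀ {y} → y ∈ map minL cs → minL C ≢ y
  helper my e with ∈-map⁻ minL my
  ... | D , dm , refl = unique-++-disjoint C u (minL-∈ neC)
        (∈-concat⁺′ (subst (_∈ D) (sym e) (minL-∈ (All.lookup ne dm))) dm)

blockOf-minL : {bs : List (List ℕ)} {B : List ℕ} → Unique (map minL bs) → B ∈ bs → blockOf bs (minL B) ≡ just B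
blockOf-minL {C ∷ cs} {B} u (here refl) rewrite ==-refl (minL C) = refl
blockOf-minL {C ∷ cs} {B} (a ∷ u) (there m)
  rewrite ==-ne (All.lookup a (∈-map⁺ minL m)) = blockOf-minL u m

blockOrSelf-just : {bs : List (List ℕ)} {a : ℕ} {B : List ℕ} → blockOf bs a ≡ just B → blockOrSelf bs a ≡ B
blockOrSelf-just {bs} {a} e with blockOf bs a | e
... | just B | refl = refl

blockRelabel-just : (σ : ℕ → ℕ) {bs : List (List ℕ)} {a : ℕ} {B : List ℕ} → blockOf bs a ≡ just B
  → FreeComp.blockRelabel HamR HamB rotEq map σ bs a ≡ minL (map σ B)
blockRelabel-just σ {bs} {a} e with blockOf bs a | e
... | just B | refl = refl

minL-singletons : (R : List ℕ) → map minL (map [_] R) ≡ R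
minL-singletons [] = refl
minL-singletons (r ∷ R) = cong (r ∷_) (minL-singletons R)

blockOrSelf-singletons : (R : List ℕ) (a : ℕ) → blockOrSelf (map [_] R) a ≡ [ a ]
blockOrSelf-singletons R a with blockOf (map [_] R) a in e
... | nothing = refl
... | just B = go R e
  where
  go : ∀ R → blockOf (map [_] R) a ≡ just B → B ≡ [ a ]
  go (r ∷ R) e' with r == a in er
  go (r ∷ R) refl | true = cong [_] (==-sound er)
  ... | false = go R e'


Symmetric : Graph → Set
Symmetric Γ = ∀ u v → adj Γ u v ≡ adj Γ v u

Sub : List ℕ → List ℕ → Set
Sub S V = ∀ x → x ∈ S → x ∈ V

CGraph-unique : {Γ : Graph} → CGraph Γ → Unique (V Γ)
CGraph-unique cg = proj₁ (proj₁ cg)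

CGraph-symmetric : {Γ : Graph} → CGraph Γ → Symmetric Γ
CGraph-symmetric cg = proj₁ (proj₂ (proj₁ cg))

CGraph-nonEmpty : {Γ : Graph} → CGraph Γ → NonEmpty (V Γ)
CGraph-nonEmpty cg = proj₁ (proj₂ cg)

edgeBetween : Graph → List ℕ → List ℕ → Bool
edgeBetween Γ B₁ B₂ = any (λ u → any (λ w → adj Γ u w) B₂) B₁

NoEdge : Graph → List ℕ → List ℕ → Set
NoEdge Γ B₁ B₂ = ∀ a b → a ∈ B₁ → b ∈ B₂ → adj Γ a b ≡ false

edgeBetween≡false⇒NoEdge : (Γ : Graph) {B₁ B₂ : List ℕ} → edgeBetween Γ B₁ B₂ ≡ false → NoEdge Γ B₁ B₂
edgeBetween≡false⇒NoEdge Γ {B₁} {B₂} e a b ma mb = any≡false⁻ (λ w → adj Γ a w) (any≡false⁻ (λ u → any (λ w → adj Γ u w) B₂) e ma) mb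

NoEdge⇒edgeBetween≡false : (Γ : Graph) {B₁ B₂ : List ℕ} → NoEdge Γ B₁ B₂ → edgeBetween Γ B₁ B₂ ≡ false
NoEdge⇒edgeBetween≡false Γ {B₁} {B₂} h = any≡false⁺ _ B₁ (λ a ma → any≡false⁺ _ B₂ (λ b mb → h a b ma mb))

edgeBetween≡true⇒edge : (Γ : Graph) {B₁ B₂ : List ℕ} → edgeBetween Γ B₁ B₂ ≡ true → ∃₂ λ a b
  → a ∈ B₁ × b ∈ B₂ × adj Γ a b ≡ true
edgeBetween≡true⇒edge Γ {B₁} {B₂} e with any≡true⁻ _ B₁ e
... | a , ma , e2 with any≡true⁻ _ B₂ e2
... | b , mb , e3 = a , b , ma , mb , e3

edgeBetween-sym : (Γ : Graph) → Symmetric Γ → (X Y : List ℕ) → edgeBetween Γ X Y ≡ edgeBetween Γ Y X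
edgeBetween-sym Γ sy X Y = ≡true⇔⇒≡ (h X Y) (h Y X)
  where
  h : ∀ X Y → edgeBetween Γ X Y ≡ true → edgeBetween Γ Y X ≡ true
  h X Y e with edgeBetween≡true⇒edge Γ {X} {Y} e
  ... | a , b , ma , mb , eab =
    any≡true⁺ (λ u → any (λ w → adj Γ u w) X) {Y} mb (any≡true⁺ (λ w → adj Γ b w) {X} ma (≡trans (sy b a) eab))

path-mono : {Γ : Graph} {S S' : List ℕ} {u v : ℕ} → Sub S S' → PathIn Γ S u v → PathIn Γ S' u v
path-mono h here = here
path-mono h (step e m p) = step e (h _ m) (path-mono h p)

path-trans : {Γ : Graph} {S : List ℕ} {u v w : ℕ} → PathIn Γ S u v → PathIn Γ S v w → PathIn Γ S u w
path-trans here q = q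
path-trans (step e m p) q = step e m (path-trans p q)

path-transport : {Γ Γ' : Graph} {S : List ℕ} {u v : ℕ} → (∀ a b → adj Γ a b ≡ adj Γ' a b)
  → PathIn Γ S u v → PathIn Γ' S u v
path-transport h here = here
path-transport h (step e m p) = step (≡trans (sym (h _ _)) e) m (path-transport h p)

tube-transport : {Γ Γ' : Graph} {S : List ℕ} → (∀ a b → adj Γ a b ≡ adj Γ' a b) → Sub S (V Γ') → Tube Γ S → Tube Γ' S
tube-transport h s (ne , u , _ , c) = ne , u , s , λ a b ma mb → path-transport h (c a b ma mb)

admissible-transport : {Γ Γ' : Graph} (t : PTree) → (∀ a b → adj Γ a b ≡ adj Γ' a b)
  → Sub (leaves t) (V Γ') → Admissible Γ t → Admissible Γ' t
admissible-transport (leaf v) h s ad = tube-transport h s ad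
admissible-transport (node l r) h s (tb , al , ar) =
  tube-transport h s tb ,
  admissible-transport l h (λ x m → s x (∈-++⁺ˡ m)) al ,
  admissible-transport r h (λ x m → s x (∈-++⁺ʳ (leaves l) m)) ar

admissible⇒tube : {Γ : Graph} (t : PTree) → Admissible Γ t → Tube Γ (leaves t)
admissible⇒tube (leaf v) a = a
admissible⇒tube (node l r) a = proj₁ a

leaves-nonEmpty : (t : PTree) → NonEmpty (leaves t)
leaves-nonEmpty (leaf v) ()
leaves-nonEmpty (node l r) = ++-nonEmpty (leaves-nonEmpty l)

singleton-tube : {Γ : Graph} {v : ℕ} → v ∈ V Γ → Tube Γ [ v ]
singleton-tube m = (λ ()) , ([] ∷ []) , (λ { x (here refl) → m }) , λ { a b (here refl) (here refl) → here }

tube-++ : {Γ : Graph} {S₁ S₂ : List ℕ} → Symmetric Γ → Tube Γ S₁ → Tube Γ S₂ → Unique (S₁ ++ S₂)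
  → ∀ a b → a ∈ S₁ → b ∈ S₂ → adj Γ a b ≡ true → Tube Γ (S₁ ++ S₂)
tube-++ {Γ} {S₁} {S₂} sy (ne1 , _ , s1 , c1) (_ , _ , s2 , c2) u a b ma mb e =
  ne , u , sub , conn
  where
  ne : NonEmpty (S₁ ++ S₂)
  ne = ++-nonEmpty ne1
  sub : Sub (S₁ ++ S₂) (V Γ)
  sub x m with ∈-++⁻ S₁ m
  ... | inj₁ m1 = s1 x m1
  ... | inj₂ m2 = s2 x m2
  L : Sub S₁ (S₁ ++ S₂)
  L x m = ∈-++⁺ˡ m
  R : Sub S₂ (S₁ ++ S₂)
  R x m = ∈-++⁺ʳ S₁ m
  conn : ∀ x y → x ∈ S₁ ++ S₂ → y ∈ S₁ ++ S₂ → PathIn Γ (S₁ ++ S₂) x y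
  conn x y mx my with ∈-++⁻ S₁ mx | ∈-++⁻ S₁ my
  ... | inj₁ x1 | inj₁ y1 = path-mono L (c1 x y x1 y1)
  ... | inj₂ x2 | inj₂ y2 = path-mono R (c2 x y x2 y2)
  ... | inj₁ x1 | inj₂ y2 = path-trans (path-mono L (c1 x a x1 ma)) (step e (R b mb) (path-mono R (c2 b y mb y2)))
  ... | inj₂ x2 | inj₁ y1 = path-trans (path-mono R (c2 x b x2 mb))
                              (step (≡trans (sy b a) e) (L a ma) (path-mono L (c1 a y ma y1)))


-- The basis elements of CycHam‾ ∘ PlanEq, read as the cyclic word of their blocks
-- (see FromHamComp and blockCycle-ham).
record BlockCycle (Γ : Graph) (cs : List (List ℕ)) : Set where
  field
    atLeastTwo         : 2 ≤ length cs
    distinct           : Unique (concat cs)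
    planarBlocks       : All (λ B → Σ PTree λ t → Admissible Γ t × leaves t ≡ B) cs
    noEdge-consecutive : ∀ P B B' Q → cs ≡ P ++ B ∷ B' ∷ Q → NoEdge Γ B B'
    noEdge-wrap        : ∀ B B' m → cs ≡ B' ∷ m ++ [ B ] → NoEdge Γ B B'

blockCycle-nonEmpty : {Γ : Graph} {cs : List (List ℕ)} → BlockCycle Γ cs → All NonEmpty cs
blockCycle-nonEmpty ch = All.map (λ { (t , _ , refl) → leaves-nonEmpty t }) (BlockCycle.planarBlocks ch)

blockCycle-block⊆V : {Γ : Graph} {cs : List (List ℕ)} → BlockCycle Γ cs → ∀ {B} → B ∈ cs → Sub B (V Γ)
blockCycle-block⊆V ch m with All.lookup (BlockCycle.planarBlocks ch) m
... | t , ad , refl = proj₁ (proj₂ (proj₂ (admissible⇒tube t ad)))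

blockCycle-disjoint : {Γ : Graph} {ds : List (List ℕ)} → BlockCycle Γ ds
  → {D₁ D₂ : List ℕ} → D₁ ∈ ds → D₂ ∈ ds → D₁ ≢ D₂ → ∀ x → x ∈ D₁ → x ∈ D₂ → ⊥
blockCycle-disjoint ch m1 m2 ne x a b = ne (same-block (BlockCycle.distinct ch) m1 m2 a b)

concat-consecutive : (ds : List (List ℕ)) → All NonEmpty ds → (p q : List ℕ) {u v : ℕ} → concat ds ≡ p ++ u ∷ v ∷ q
  → (∃ λ D → D ∈ ds × u ∈ D × v ∈ D) ⊎ (∃₂ λ P Q → ∃₂ λ D D' → ds ≡ P ++ D ∷ D' ∷ Q × u ∈ D × v ∈ D')
concat-consecutive [] _ p q eq with p
concat-consecutive [] _ p q () | []
concat-consecutive [] _ p q () | _ ∷ _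
concat-consecutive (D ∷ es) (neD ∷ ne) p q {u} {v} eq with ++≡++-split D (concat es) p (u ∷ v ∷ q) eq
... | inj₂ (e , pe , ce) with concat-consecutive es ne e q ce
...   | inj₁ (E , mE , a , b) = inj₁ (E , there mE , a , b)
...   | inj₂ (P , Q , E , E' , deq , a , b) = inj₂ (D ∷ P , Q , E , E' , cong (D ∷_) deq , a , b)
concat-consecutive (D ∷ es) (neD ∷ ne) p q {u} {v} eq | inj₁ ([] , De , ce) with concat-consecutive es ne [] q (sym ce)
...   | inj₁ (E , mE , a , b) = inj₁ (E , there mE , a , b)
...   | inj₂ (P , Q , E , E' , deq , a , b) = inj₂ (D ∷ P , Q , E , E' , cong (D ∷_) deq , a , b)
concat-consecutive (D ∷ es) (neD ∷ ne) p q {u} {v} eq | inj₁ (w ∷ [] , De , ce) with ∷-injective ce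
... | refl , ce2 with es | ne
... | [] | _ with ce2
... | ()
concat-consecutive (D ∷ es) (neD ∷ ne) p q {u} {v} eq | inj₁ (w ∷ [] , De , ce) | refl , ce2 | E ∷ es' | neE ∷ _ =
  inj₂ ([] , es' , D , E , refl , subst (u ∈_) (sym De) (∈-++⁺ʳ p (here refl)) , head-∈ neE (sym ce2))
concat-consecutive (D ∷ es) (neD ∷ ne) p q {u} {v} eq | inj₁ (w ∷ w' ∷ e , De , ce) with ∷-injective ce
... | refl , ce2 with ∷-injective ce2
... | refl , _ = inj₁ (D , here refl , subst (u ∈_) (sym De) (∈-++⁺ʳ p (here refl)) ,
                       subst (v ∈_) (sym De) (∈-++⁺ʳ p (there (here refl))))

concat-wrap : (ds : List (List ℕ)) → All NonEmpty ds → 2 ≤ length ds → {u v : ℕ} {q : List ℕ}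
  → concat ds ≡ v ∷ q ++ [ u ] → ∃₂ λ D D' → ∃ λ m → ds ≡ D' ∷ m ++ [ D ] × u ∈ D × v ∈ D'
concat-wrap (D' ∷ []) _ (s≤s ())
concat-wrap (D' ∷ E ∷ es) (ne' ∷ ne) _ {u} {v} {q} eq with ∃-init-last {xs = E ∷ es} (λ ())
... | m , D , e = D , D' , m , cong (D' ∷_) e ,
   last-∈ (D' ++ concat m) {Y = v ∷ q} (All.lookup ne (subst (D ∈_) (sym e) (∈-++⁺ʳ m (here refl))))
     (≡trans (sym (≡trans (cong (λ z → D' ++ concat z) e)
        (≡trans (cong (D' ++_) (≡trans (sym (concat-++ m [ D ])) (cong (concat m ++_) (++-identityʳ D))))
          (sym (++-assoc D' (concat m) D))))) eq) ,
   head-∈ ne' eq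

module _ {Γ : Graph} {ds : List (List ℕ)} (ch : BlockCycle Γ ds) {u v : ℕ} {D₁ D₂ : List ℕ}
  (m1 : D₁ ∈ ds) (m2 : D₂ ∈ ds) (u1 : u ∈ D₁) (v2 : v ∈ D₂) (ne : D₁ ≢ D₂) where
  private
    U = BlockCycle.distinct ch
    NE = blockCycle-nonEmpty ch
  consecutive⇒NoEdge : ∀ p q' → concat ds ≡ p ++ u ∷ v ∷ q' → NoEdge Γ D₁ D₂
  consecutive⇒NoEdge p q' e with concat-consecutive ds NE p q' e
  ... | inj₁ (D , mD , uD , vD) = ⊥-elim (ne (≡trans (same-block U m1 mD u1 uD) (same-block U mD m2 vD v2)))
  ... | inj₂ (P , Q , D , D' , deq , uD , vD) =
    subst₂ (NoEdge Γ) (sym (same-block U m1 mD u1 uD)) (sym (same-block U m2 mD' v2 vD))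
      (BlockCycle.noEdge-consecutive ch P D D' Q deq)
    where
    mD : D ∈ ds
    mD = subst (D ∈_) (sym deq) (∈-middle P)
    mD' : D' ∈ ds
    mD' = subst (D' ∈_) (sym deq) (∈-++⁺ʳ P (there (here refl)))
  wrap⇒NoEdge : ∀ q' → concat ds ≡ v ∷ q' ++ [ u ] → NoEdge Γ D₁ D₂
  wrap⇒NoEdge q' e with concat-wrap ds NE (BlockCycle.atLeastTwo ch) e
  ... | D , D' , m , deq , uD , vD =
    subst₂ (NoEdge Γ) (sym (same-block U m1 mD u1 uD)) (sym (same-block U m2 mD' v2 vD))
      (BlockCycle.noEdge-wrap ch D D' m deq)
    where
    mD : D ∈ ds
    mD = subst (D ∈_) (sym deq) (there (∈-++⁺ʳ m (here refl)))
    mD' : D' ∈ ds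
    mD' = subst (D' ∈_) (sym deq) (here refl)

blockCycle-step-NoEdge : {Γ : Graph} {ds : List (List ℕ)} → BlockCycle Γ ds → {u v : ℕ} {q : List ℕ}
  → Rot (concat ds) (u ∷ v ∷ q)
  → {D₁ D₂ : List ℕ} → D₁ ∈ ds → D₂ ∈ ds → u ∈ D₁ → v ∈ D₂ → D₁ ≢ D₂ → NoEdge Γ D₁ D₂
blockCycle-step-NoEdge ch {q = q} (a , [] , ceq , reqn) m1 m2 u1 v2 ne =
  consecutive⇒NoEdge ch m1 m2 u1 v2 ne [] q (≡trans ceq (≡trans (++-identityʳ a) (sym reqn)))
blockCycle-step-NoEdge ch {q = q} (a , w ∷ [] , ceq , reqn) m1 m2 u1 v2 ne with ∷-injective reqn
... | refl , refl = wrap⇒NoEdge ch m1 m2 u1 v2 ne q ceq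
blockCycle-step-NoEdge ch {q = q} (a , w ∷ w' ∷ b' , ceq , reqn) m1 m2 u1 v2 ne with ∷-injective reqn
... | refl , r2 with ∷-injective r2
... | refl , _ = consecutive⇒NoEdge ch m1 m2 u1 v2 ne a b' ceq

no-path-across : {Γ : Graph} {S D₁ D₂ : List ℕ} {a b : ℕ} → PathIn Γ S a b
  → (∀ x → x ∈ S → x ∈ D₁ ⊎ x ∈ D₂) → (∀ x → x ∈ D₁ → x ∈ D₂ → ⊥) → NoEdge Γ D₁ D₂
  → a ∈ D₁ → b ∈ D₂ → ⊥
no-path-across here sp dj ne ma mb = dj _ ma mb
no-path-across {a = a} (step {w = w} e m p) sp dj ne ma mb with sp w m
... | inj₁ w1 = no-path-across p sp dj ne w1 mb
... | inj₂ w2 with ≡trans (sym e) (ne a w ma w2)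
... | ()

-- By induction the two subtrees lie in blocks D₁ and D₂. Where their leaves meet, two consecutive
-- letters of the cycle lie in D₁ and D₂; if D₁ ≢ D₂ no edge joins them, so the root is no tube.
tree-within-block : {Γ : Graph} {ds : List (List ℕ)} → BlockCycle Γ ds → (t : PTree) → Admissible Γ t
  → CyclicInfix (concat ds) (leaves t)
  → ∃ λ D → D ∈ ds × Sub (leaves t) D
tree-within-block {Γ} {ds} ch (leaf v) ad (q , r) with ∈-concat⁻′ ds (∈-resp-↭ (↭-sym (rot⇒↭ r)) (here refl))
... | D , vD , mD = D , mD , λ { x (here refl) → vD }
tree-within-block {Γ} {ds} ch (node l r) (tb , al , ar) ci
  with tree-within-block ch l al (cyclicInfix-++ˡ (leaves l) (leaves r) ci) | tree-within-block ch r ar (cyclicInfix-++ʳ (leaves l) (leaves r) ci)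
... | D₁ , m1 , s1 | D₂ , m2 , s2 with ≡-dec _≟_ D₁ D₂
... | yes refl = D₁ , m1 , λ x m → [ s1 x , s2 x ]′ (∈-++⁻ (leaves l) m)
... | no ne with cyclicInfix-junction (leaves l) (leaves r) (leaves-nonEmpty l) (leaves-nonEmpty r) ci
... | u , v , q , rq , ul , vr =
  ⊥-elim (no-path-across (proj₂ (proj₂ (proj₂ tb)) u v (∈-++⁺ˡ ul) (∈-++⁺ʳ (leaves l) vr))
     (λ x m → ⊎-map (s1 x) (s2 x) (∈-++⁻ (leaves l) m))
     (blockCycle-disjoint ch m1 m2 ne) (blockCycle-step-NoEdge ch rq m1 m2 (s1 u ul) (s2 v vr) ne) (s1 u ul) (s2 v vr))

blockCycle-not-planar : {Γ : Graph} {ds : List (List ℕ)} → BlockCycle Γ ds → (t : PTree) → Admissible Γ t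
  → Rot (concat ds) (leaves t) → ⊥
blockCycle-not-planar {Γ} {ds} ch t ad r with tree-within-block ch t ad ([] , subst (Rot (concat ds)) (sym (++-identityʳ (leaves t))) r)
... | D , mD , sD with ds | BlockCycle.atLeastTwo ch | blockCycle-nonEmpty ch | BlockCycle.distinct ch | mD
... | [] | () | _ | _ | _
... | _ ∷ [] | s≤s () | _ | _ | _
... | E₁ ∷ E₂ ∷ es | _ | ne1 ∷ ne2 ∷ _ | U | mD' with ≡-dec _≟_ D E₁
...   | yes refl = unique-++-disjoint D U (sD y (inLeaves (∈-++⁺ʳ D (∈-++⁺ˡ yE))))
          (∈-++⁺ˡ yE)
  where
  y = proj₁ (nonEmpty-element ne2)
  yE = proj₂ (nonEmpty-element ne2)
  inLeaves : ∀ {z} → z ∈ concat (E₁ ∷ E₂ ∷ es) → z ∈ leaves t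
  inLeaves m = ∈-resp-↭ (rot⇒↭ r) m
...   | no neq = neq (sym (same-block U (here refl) mD' yE (sD y (∈-resp-↭ (rot⇒↭ r) (∈-++⁺ˡ yE)))))
  where
  y = proj₁ (nonEmpty-element ne1)
  yE = proj₂ (nonEmpty-element ne1)


sameBlock : List (List ℕ) → ℕ → ℕ → Bool
sameBlock ds x y = any (λ D → (x ∈ᵇ D) ∧ (y ∈ᵇ D)) ds

sameBlock⁺ : {ds : List (List ℕ)} {D : List ℕ} {x y : ℕ} → D ∈ ds → x ∈ D → y ∈ D → sameBlock ds x y ≡ true
sameBlock⁺ {ds} {D} {x} {y} mD mx my = any≡true⁺ (λ D → (x ∈ᵇ D) ∧ (y ∈ᵇ D)) mD (∧≡true⁺ (∈⇒∈ᵇ mx) (∈⇒∈ᵇ my))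

sameBlock⁻ : {ds : List (List ℕ)} {x y : ℕ} → sameBlock ds x y ≡ true → ∃ λ D → D ∈ ds × x ∈ D × y ∈ D
sameBlock⁻ {ds} {x} {y} e with any≡true⁻ _ ds e
... | D , mD , q = D , mD , ∈ᵇ⇒∈ (proj₁ (∧≡true⁻ q)) , ∈ᵇ⇒∈ (proj₂ (∧≡true⁻ q))

consRun : (A → A → Bool) → A → List (List A) → List (List A)
consRun p x [] = [ [ x ] ]
consRun p x ([] ∷ bs) = [ x ] ∷ [] ∷ bs
consRun p x ((y ∷ b) ∷ bs) = if p x y then (x ∷ y ∷ b) ∷ bs else [ x ] ∷ (y ∷ b) ∷ bs

runs : (A → A → Bool) → List A → List (List A)
runs p = foldr (consRun p) []

runs-cong : {p p' : A → A → Bool} → (∀ x y → p x y ≡ p' x y) → (c : List A) → runs p c ≡ runs p' c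
runs-cong h [] = refl
runs-cong {p = p} {p' = p'} h (x ∷ c) rewrite runs-cong h c = go (runs p' c)
  where
  go : ∀ bs → consRun p x bs ≡ consRun p' x bs
  go [] = refl
  go ([] ∷ bs) = refl
  go ((y ∷ b) ∷ bs) rewrite h x y = refl

runs-head : (p : A → A → Bool) (v : A) (b : List A) → ∃₂ λ b₁ bs → runs p (v ∷ b) ≡ (v ∷ b₁) ∷ bs
runs-head p v [] = [] , [] , refl
runs-head p v (w ∷ b) with runs-head p w b
... | b₁ , bs , e rewrite e with p v w
... | true = w ∷ b₁ , bs , refl
... | false = [] , (w ∷ b₁) ∷ bs , refl

consRun-++ : (p : A → A → Bool) (x y : A) (b : List A) (bs Z : List (List A))
  → consRun p x (((y ∷ b) ∷ bs) ++ Z) ≡ consRun p x ((y ∷ b) ∷ bs) ++ Z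
consRun-++ p x y b bs Z with p x y
... | true = refl
... | false = refl

runs-++ : (p : A → A → Bool) (a b : List A) → NonEmpty a → NonEmpty b
  → (∀ a0 u v b' → a ≡ a0 ++ [ u ] → b ≡ v ∷ b' → p u v ≡ false)
  → runs p (a ++ b) ≡ runs p a ++ runs p b
runs-++ p [] b ne _ _ = ⊥-elim (ne refl)
runs-++ p (u ∷ []) [] _ ne _ = ⊥-elim (ne refl)
runs-++ p (u ∷ []) (v ∷ b') _ _ h with runs-head p v b'
... | b₁ , bs , e rewrite e | h [] u v b' refl refl = refl
runs-++ p (x ∷ y ∷ a) b _ nb h
  with runs-++ p (y ∷ a) b (λ ()) nb (λ a0 u v b' ea eb → h (x ∷ a0) u v b' (cong (x ∷_) ea) eb)
     | runs-head p y a
... | ih | b₁ , bs , e rewrite ih | e = consRun-++ p x y b₁ bs (runs p b)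

runs-block : (p : A → A → Bool) (es : List (List A)) → All NonEmpty es → (B : List A) → NonEmpty B
  → (∀ x y → x ∈ B → y ∈ B → p x y ≡ true)
  → (∀ E es' → es ≡ E ∷ es' → ∀ x y → x ∈ B → y ∈ E → p x y ≡ false)
  → foldr (consRun p) es B ≡ B ∷ es
runs-block p es ne [] nb _ _ = ⊥-elim (nb refl)
runs-block p [] ne (x ∷ []) _ _ hb' = refl
runs-block p ([] ∷ es') (ne0 ∷ _) (x ∷ []) _ _ hb' = ⊥-elim (ne0 refl)
runs-block p ((y ∷ b) ∷ es') ne (x ∷ []) _ _ hb' rewrite hb' (y ∷ b) es' refl x y (here refl) (here refl) = refl
runs-block p es ne (x ∷ x' ∷ B) _ hin' hb'
  rewrite runs-block p es ne (x' ∷ B) (λ ()) (λ a b ma mb → hin' a b (there ma) (there mb))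
            (λ E es' e a b ma mb → hb' E es' e a b (there ma) mb)
        | hin' x x' (here refl) (there (here refl)) = refl

runs-concat : (p : A → A → Bool) (ds : List (List A)) → All NonEmpty ds
  → (∀ D → D ∈ ds → ∀ x y → x ∈ D → y ∈ D → p x y ≡ true)
  → (∀ P D D' Q → ds ≡ P ++ D ∷ D' ∷ Q → ∀ x y → x ∈ D → y ∈ D' → p x y ≡ false)
  → runs p (concat ds) ≡ ds
runs-concat p [] _ _ _ = refl
runs-concat p (D ∷ es) (neD ∷ ne) hin hb
  rewrite foldr-++ (consRun p) [] D (concat es)
        | runs-concat p es ne (λ E m → hin E (there m)) (λ P E E' Q e → hb (D ∷ P) E E' Q (cong (D ∷_) e))
  = runs-block p es ne D neD (λ x y mx my → hin D (here refl) x y mx my) (λ E es' e x y mx my → hb [] D E es' (cong (D ∷_) e) x y mx my)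

blockCycle-runs : {Γ : Graph} {ds : List (List ℕ)} → BlockCycle Γ ds → runs (sameBlock ds) (concat ds) ≡ ds
blockCycle-runs {Γ} {ds} ch = runs-concat (sameBlock ds) ds (blockCycle-nonEmpty ch)
  (λ D mD x y mx my → sameBlock⁺ mD mx my)
  (λ P D D' Q e x y mx my → ≢true⇒≡false λ s → hb P D D' Q e x y mx my s)
  where
  hb : ∀ P D D' Q → ds ≡ P ++ D ∷ D' ∷ Q → ∀ x y → x ∈ D → y ∈ D' → sameBlock ds x y ≡ true → ⊥
  hb P D D' Q e x y mx my s with sameBlock⁻ s
  ... | E , mE , xE , yE with same-block (BlockCycle.distinct ch) mE (subst (D ∈_) (sym e) (∈-middle P)) xE mx
                            | same-block (BlockCycle.distinct ch) mE (subst (D' ∈_) (sym e) (∈-++⁺ʳ P (there (here refl)))) yE my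
  ... | refl | refl = concat-consecutive-disjoint P (subst (λ z → Unique (concat z)) e (BlockCycle.distinct ch)) x mx mx

blockCycle-wrap-sameBlock : {Γ : Graph} {ds : List (List ℕ)} → BlockCycle Γ ds
  → {D D' : List ℕ} {m : List (List ℕ)} → ds ≡ D' ∷ m ++ [ D ]
  → {x y : ℕ} → x ∈ D → y ∈ D' → sameBlock ds x y ≡ false
blockCycle-wrap-sameBlock {Γ} {ds} ch {D} {D'} {m} e {x} {y} mx my = ≢true⇒≡false h
  where
  h : sameBlock ds x y ≡ true → ⊥
  h s with sameBlock⁻ s
  ... | E , mE , xE , yE with same-block (BlockCycle.distinct ch) mE (subst (D ∈_) (sym e) (there (∈-++⁺ʳ m (here refl)))) xE mx
                            | same-block (BlockCycle.distinct ch) mE (subst (D' ∈_) (sym e) (here refl)) yE my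
  ... | refl | refl = concat-wrap-disjoint m (subst (λ z → Unique (concat z)) e (BlockCycle.distinct ch)) y my my

blockCycle-sameBlock-rot : {Γ : Graph} {cs ds : List (List ℕ)} → BlockCycle Γ cs → BlockCycle Γ ds
  → Rot (concat cs) (concat ds)
  → ∀ {x y} → sameBlock cs x y ≡ true → sameBlock ds x y ≡ true
blockCycle-sameBlock-rot {Γ} {cs} {ds} chc chd r {x} {y} s with sameBlock⁻ {cs} {x} {y} s
... | D , mD , xD , yD with All.lookup (BlockCycle.planarBlocks chc) mD | ∈-∃++ mD
... | t , ad , refl | P , Q , ceq with tree-within-block chd t ad (concat Q ++ concat P , rot-trans (rot-sym r) rr)
  where
  rr : Rot (concat cs) (leaves t ++ concat Q ++ concat P)
  rr = concat P , leaves t ++ concat Q ,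
       ≡trans (cong concat ceq) (sym (concat-++ P (leaves t ∷ Q))) ,
       sym (++-assoc (leaves t) (concat Q) (concat P))
... | E , mE , sE = sameBlock⁺ {ds} {E} {x} {y} mE (sE _ xD) (sE _ yD)

-- Both block sequences are the maximal runs of the same relation (blockCycle-sameBlock-rot),
-- and the cut point of the rotation is a block boundary on both sides.
blockCycle-unique : {Γ : Graph} {cs ds : List (List ℕ)} → BlockCycle Γ cs → BlockCycle Γ ds
  → Rot (concat cs) (concat ds) → Rot′ cs ds
blockCycle-unique {Γ} {cs} {ds} chc chd r@(a , b , ceq , deq) = go a b ceq deq
  where
  p = sameBlock cs
  agr : ∀ x y → sameBlock ds x y ≡ p x y
  agr x y = ≡true⇔⇒≡ (blockCycle-sameBlock-rot chd chc (rot-sym r) {x} {y}) (blockCycle-sameBlock-rot chc chd r {x} {y})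
  csE : runs p (concat cs) ≡ cs
  csE = blockCycle-runs chc
  dsE : runs p (concat ds) ≡ ds
  dsE = ≡trans (sym (runs-cong agr (concat ds))) (blockCycle-runs chd)
  go : ∀ a b → concat cs ≡ a ++ b → concat ds ≡ b ++ a → Rot′ cs ds
  same-concat : concat cs ≡ concat ds → cs ≡ ds
  same-concat e = ≡trans (sym csE) (≡trans (cong (runs p) e) dsE)
  go [] b ce de = subst (Rot′ cs) (same-concat (≡trans ce (sym (≡trans de (++-identityʳ b))))) (rot-refl cs)
  go (z ∷ a') [] ce de = subst (Rot′ cs) (same-concat (≡trans ce (≡trans (++-identityʳ _) (sym de)))) (rot-refl cs)
  go a@(z ∷ a') b@(v ∷ b') ce de =
    runs p a , runs p b ,
    ≡trans (sym csE) (≡trans (cong (runs p) ce) (runs-++ p a b (λ ()) (λ ()) h1)) ,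
    ≡trans (sym dsE) (≡trans (cong (runs p) de) (runs-++ p b a (λ ()) (λ ()) h2))
    where
    h1 : ∀ a0 u v₁ b'' → a ≡ a0 ++ [ u ] → b ≡ v₁ ∷ b'' → p u v₁ ≡ false
    h1 a0 u v₁ b'' ea eb with concat-wrap ds (blockCycle-nonEmpty chd) (BlockCycle.atLeastTwo chd) {u} {v₁} {b'' ++ a0}
                                     (≡trans de (≡trans (cong₂ _++_ eb ea) (cong (v₁ ∷_) (sym (++-assoc b'' a0 [ u ])))))
    ... | D , D' , m , e , uD , vD = ≡trans (sym (agr u v₁)) (blockCycle-wrap-sameBlock chd e uD vD)
    h2 : ∀ b0 w z₁ a'' → b ≡ b0 ++ [ w ] → a ≡ z₁ ∷ a'' → p w z₁ ≡ false
    h2 b0 w z₁ a'' eb ea with concat-wrap cs (blockCycle-nonEmpty chc) (BlockCycle.atLeastTwo chc) {w} {z₁} {a'' ++ b0}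
                                     (≡trans ce (≡trans (cong₂ _++_ ea eb) (cong (z₁ ∷_) (sym (++-assoc a'' b0 [ w ])))))
    ... | D , D' , m , e , uD , vD = blockCycle-wrap-sameBlock chc e uD vD


leavesOf : List PTree → List ℕ
leavesOf ts = concat (map leaves ts)

treesAdjacent : Graph → PTree → PTree → Bool
treesAdjacent Γ t₁ t₂ = edgeBetween Γ (leaves t₁) (leaves t₂)

mergeFirst : Graph → List PTree → Maybe (List PTree)
mergeFirst Γ (t₁ ∷ t₂ ∷ ts) = if treesAdjacent Γ t₁ t₂ then just (node t₁ t₂ ∷ ts)
  else Maybe.map (t₁ ∷_) (mergeFirst Γ (t₂ ∷ ts))
mergeFirst Γ _ = nothing

rotate : List PTree → List PTree
rotate [] = []
rotate (t ∷ ts) = ts ++ [ t ]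

-- The pair (last tree, first tree) is tried by rotating once.
mergeStep : Graph → List PTree → Maybe (List PTree)
mergeStep Γ ts with mergeFirst Γ ts
... | just ts' = just ts'
... | nothing = mergeFirst Γ (rotate ts)

mergeLoop : Graph → ℕ → List PTree → List PTree
mergeLoop Γ zero ts = ts
mergeLoop Γ (suc n) ts with mergeStep Γ ts
... | just ts' = mergeLoop Γ n ts'
... | nothing = ts

-- Each successful step removes a tree, so length x steps reach the end (mergeLoop-stuck).
greedy : Graph → List ℕ → List PTree
greedy Γ x = mergeLoop Γ (length x) (map leaf x)

Forest : Graph → List PTree → Set
Forest Γ ts = All (Admissible Γ) ts × Unique (leavesOf ts) × Sub (leavesOf ts) (V Γ)

mergeFirst-leaves : (Γ : Graph) (ts : List PTree) {ts' : List PTree} → mergeFirst Γ ts ≡ just ts'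
  → leavesOf ts' ≡ leavesOf ts × suc (length ts') ≡ length ts
mergeFirst-leaves Γ (t₁ ∷ t₂ ∷ ts) e with treesAdjacent Γ t₁ t₂
mergeFirst-leaves Γ (t₁ ∷ t₂ ∷ ts) refl | true = ++-assoc (leaves t₁) (leaves t₂) (leavesOf ts) , refl
... | false with mergeFirst Γ (t₂ ∷ ts) in eq
mergeFirst-leaves Γ (t₁ ∷ t₂ ∷ ts) refl | false | just ts'' with mergeFirst-leaves Γ (t₂ ∷ ts) eq
... | c , l = cong (leaves t₁ ++_) c , cong suc l

mergeFirst-admissible : (Γ : Graph) (ts : List PTree) {ts' : List PTree} → Symmetric Γ → Unique (leavesOf ts)
  → Sub (leavesOf ts) (V Γ) → All (Admissible Γ) ts → mergeFirst Γ ts ≡ just ts' → All (Admissible Γ) ts'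
mergeFirst-admissible Γ (t₁ ∷ t₂ ∷ ts) sy u s (a1 ∷ a2 ∷ as) e with treesAdjacent Γ t₁ t₂ in eqa
mergeFirst-admissible Γ (t₁ ∷ t₂ ∷ ts) sy u s (a1 ∷ a2 ∷ as) refl | true with edgeBetween≡true⇒edge Γ eqa
... | a , b , ma , mb , eab =
  (tube-++ sy (admissible⇒tube t₁ a1) (admissible⇒tube t₂ a2) u12 a b ma mb eab , a1 , a2) ∷ as
  where
  u12 : Unique (leaves t₁ ++ leaves t₂)
  u12 = unique-++ˡ (subst Unique (sym (++-assoc (leaves t₁) (leaves t₂) (leavesOf ts))) u)
mergeFirst-admissible Γ (t₁ ∷ t₂ ∷ ts) sy u s (a1 ∷ as) e | false with mergeFirst Γ (t₂ ∷ ts) in eq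
mergeFirst-admissible Γ (t₁ ∷ t₂ ∷ ts) sy u s (a1 ∷ as) refl | false | just ts'' =
  a1 ∷ mergeFirst-admissible Γ (t₂ ∷ ts) sy (unique-++ʳ (leaves t₁) u) (λ x m → s x (∈-++⁺ʳ (leaves t₁) m)) as eq

rotate-rot : (ts : List PTree) → Rot′ ts (rotate ts)
rotate-rot [] = rot-refl []
rotate-rot (t ∷ ts) = [ t ] , ts , refl , refl

leavesOf-rot : {ts ts' : List PTree} → Rot′ ts ts' → Rot (leavesOf ts) (leavesOf ts')
leavesOf-rot r = rot-concat (rot-map leaves r)

forest-rot : (Γ : Graph) {ts ts' : List PTree} → Rot′ ts ts' → Forest Γ ts → Forest Γ ts'
forest-rot Γ r (a , u , s) = All-resp-↭ (rot⇒↭ r) a , unique-resp-↭ (rot⇒↭ (leavesOf-rot r)) u ,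
  λ x m → s x (∈-resp-↭ (↭-sym (rot⇒↭ (leavesOf-rot r))) m)

forest-leaves-≡ : (Γ : Graph) {ts ts' : List PTree} → leavesOf ts' ≡ leavesOf ts → All (Admissible Γ) ts'
  → Forest Γ ts → Forest Γ ts'
forest-leaves-≡ Γ e a' (a , u , s) rewrite e = a' , u , s

mergeFirst-forest : (Γ : Graph) (ts : List PTree) {ts' : List PTree} → Symmetric Γ → Forest Γ ts
  → mergeFirst Γ ts ≡ just ts'
  → Forest Γ ts' × Rot (leavesOf ts) (leavesOf ts')
mergeFirst-forest Γ ts sy f@(a , u , s) e with mergeFirst-leaves Γ ts e
... | c , _ = forest-leaves-≡ Γ c (mergeFirst-admissible Γ ts sy u s a e) f , subst (Rot (leavesOf ts)) (sym c) (rot-refl _)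

mergeStep-forest : (Γ : Graph) (ts : List PTree) {ts' : List PTree} → Symmetric Γ → Forest Γ ts
  → mergeStep Γ ts ≡ just ts'
  → Forest Γ ts' × Rot (leavesOf ts) (leavesOf ts')
mergeStep-forest Γ ts sy f e with mergeFirst Γ ts in eq
mergeStep-forest Γ ts sy f refl | just ts' = mergeFirst-forest Γ ts sy f eq
mergeStep-forest Γ ts sy f e | nothing with mergeFirst-forest Γ (rotate ts) sy (forest-rot Γ (rotate-rot ts) f) e
... | f' , r = f' , rot-trans (leavesOf-rot (rotate-rot ts)) r

mergeLoop-forest : (Γ : Graph) (n : ℕ) (ts : List PTree) → Symmetric Γ → Forest Γ ts
  → Forest Γ (mergeLoop Γ n ts) × Rot (leavesOf ts) (leavesOf (mergeLoop Γ n ts))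
mergeLoop-forest Γ zero    ts sy f = f , rot-refl _
mergeLoop-forest Γ (suc n) ts sy f with mergeStep Γ ts in eq
... | nothing = f , rot-refl _
... | just ts' with mergeStep-forest Γ ts sy f eq
... | f' , r with mergeLoop-forest Γ n ts' sy f'
... | f'' , r' = f'' , rot-trans r r'

mergeStep-rot : (Γ : Graph) (ts : List PTree) {ts' : List PTree} → mergeStep Γ ts ≡ just ts'
  → Rot (leavesOf ts) (leavesOf ts')
mergeStep-rot Γ ts e with mergeFirst Γ ts in eq
mergeStep-rot Γ ts refl | just ts' = subst (Rot (leavesOf ts)) (sym (proj₁ (mergeFirst-leaves Γ ts eq))) (rot-refl _)
... | nothing = rot-trans (leavesOf-rot (rotate-rot ts))
  (subst (Rot (leavesOf (rotate ts))) (sym (proj₁ (mergeFirst-leaves Γ (rotate ts) e))) (rot-refl _))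

Sub-resp-rot : {L L' V : List ℕ} → Rot L L' → Sub L V → Sub L' V
Sub-resp-rot r s z m = s z (∈-resp-↭ (↭-sym (rot⇒↭ r)) m)

mergeFirst-length : (Γ : Graph) (ts : List PTree) {ts' : List PTree} → mergeFirst Γ ts ≡ just ts'
  → suc (length ts') ≡ length ts
mergeFirst-length Γ ts e = proj₂ (mergeFirst-leaves Γ ts e)

mergeStep-length : (Γ : Graph) (ts : List PTree) {ts' : List PTree} → mergeStep Γ ts ≡ just ts'
  → suc (length ts') ≡ length ts
mergeStep-length Γ ts e with mergeFirst Γ ts in eq
mergeStep-length Γ ts refl | just ts' = mergeFirst-length Γ ts eq
mergeStep-length Γ ts e | nothing = ≡trans (mergeFirst-length Γ (rotate ts) e) (↭-length (rot⇒↭ (rot-sym (rotate-rot ts))))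

mergeStep-short : (Γ : Graph) (ts : List PTree) → length ts ≤ 1 → mergeStep Γ ts ≡ nothing
mergeStep-short Γ [] _ = refl
mergeStep-short Γ (t ∷ []) _ = refl
mergeStep-short Γ (t ∷ t' ∷ ts) (s≤s ())

mergeLoop-stuck : (Γ : Graph) (n : ℕ) (ts : List PTree) → length ts ≤ suc n → mergeStep Γ (mergeLoop Γ n ts) ≡ nothing
mergeLoop-stuck Γ zero ts l = mergeStep-short Γ ts l
mergeLoop-stuck Γ (suc n) ts l with mergeStep Γ ts in eq
... | nothing = eq
... | just ts' = mergeLoop-stuck Γ n ts' (≤-pred (subst (_≤ suc (suc n)) (sym (mergeStep-length Γ ts eq)) l))

mergeStep-nothing : (Γ : Graph) (ts : List PTree) → mergeStep Γ ts ≡ nothing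
  → mergeFirst Γ ts ≡ nothing × mergeFirst Γ (rotate ts) ≡ nothing
mergeStep-nothing Γ ts e with mergeFirst Γ ts
mergeStep-nothing Γ ts () | just _
... | nothing = refl , e

mergeFirst-nothing-linear : (Γ : Graph) (ts : List PTree) → mergeFirst Γ ts ≡ nothing
  → ∀ P B B' Q → map leaves ts ≡ P ++ B ∷ B' ∷ Q → edgeBetween Γ B B' ≡ false
mergeFirst-nothing-linear Γ (t₁ ∷ t₂ ∷ ts) e P B B' Q eq with treesAdjacent Γ t₁ t₂ in eqa
mergeFirst-nothing-linear Γ (t₁ ∷ t₂ ∷ ts) () P B B' Q eq | true
... | false with mergeFirst Γ (t₂ ∷ ts) in eqm
mergeFirst-nothing-linear Γ (t₁ ∷ t₂ ∷ ts) () P B B' Q eq | false | just _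
mergeFirst-nothing-linear Γ (t₁ ∷ t₂ ∷ ts) e [] B B' Q eq | false | nothing with ∷-injective eq
... | refl , eq2 with ∷-injective eq2
... | refl , _ = eqa
mergeFirst-nothing-linear Γ (t₁ ∷ t₂ ∷ ts) e (p ∷ P) B B' Q eq | false | nothing =
  mergeFirst-nothing-linear Γ (t₂ ∷ ts) eqm P B B' Q (proj₂ (∷-injective eq))
mergeFirst-nothing-linear Γ [] e [] B B' Q ()
mergeFirst-nothing-linear Γ [] e (_ ∷ _) B B' Q ()
mergeFirst-nothing-linear Γ (t ∷ []) e [] B B' Q ()
mergeFirst-nothing-linear Γ (t ∷ []) e (p ∷ []) B B' Q ()
mergeFirst-nothing-linear Γ (t ∷ []) e (p ∷ _ ∷ _) B B' Q ()

mergeFirst-nothing-wrap : (Γ : Graph) (ts : List PTree) → mergeFirst Γ (rotate ts) ≡ nothing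
  → ∀ B B' m → map leaves ts ≡ B' ∷ m ++ [ B ] → edgeBetween Γ B B' ≡ false
mergeFirst-nothing-wrap Γ (t ∷ ts) e B B' m eq with ∷-injective eq
... | e1 , e2 = mergeFirst-nothing-linear Γ (ts ++ [ t ]) e m B B' []
  (≡trans (map-++ leaves ts [ t ]) (≡trans (cong₂ _++_ e2 (cong [_] e1)) (++-assoc m [ B ] [ B' ])))

leaves-trees : {Γ : Graph} (ts : List PTree) → All (Admissible Γ) ts
  → All (λ B → Σ PTree λ t → Admissible Γ t × leaves t ≡ B) (map leaves ts)
leaves-trees []       []       = []
leaves-trees (t ∷ ts) (a ∷ as) = (t , a , refl) ∷ leaves-trees ts as

stuck-forest-blockCycle : {Γ : Graph} (ts : List PTree) → Forest Γ ts → 2 ≤ length ts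
  → mergeStep Γ ts ≡ nothing → BlockCycle Γ (map leaves ts)
stuck-forest-blockCycle {Γ} ts (as , u , _) two stuck = record
  { atLeastTwo         = subst (2 ≤_) (sym (length-map leaves ts)) two
  ; distinct           = u
  ; planarBlocks       = leaves-trees ts as
  ; noEdge-consecutive = λ P B B' Q eq →
      edgeBetween≡false⇒NoEdge Γ (mergeFirst-nothing-linear Γ ts (proj₁ stuck′) P B B' Q eq)
  ; noEdge-wrap        = λ B B' m eq →
      edgeBetween≡false⇒NoEdge Γ (mergeFirst-nothing-wrap Γ ts (proj₂ stuck′) B B' m eq)
  }
  where
  stuck′ = mergeStep-nothing Γ ts stuck

data GreedyOutcome (Γ : Graph) (x : List ℕ) : List PTree → Set where
  empty  : x ≡ [] → GreedyOutcome Γ x []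
  planar : ∀ t → Admissible Γ t → Rot x (leaves t) → GreedyOutcome Γ x (t ∷ [])
  cycle  : ∀ t₁ t₂ ts → BlockCycle Γ (map leaves (t₁ ∷ t₂ ∷ ts)) → Rot x (leavesOf (t₁ ∷ t₂ ∷ ts))
           → GreedyOutcome Γ x (t₁ ∷ t₂ ∷ ts)

stuck-forest-outcome : {Γ : Graph} {x : List ℕ} (ts : List PTree) → Forest Γ ts → Rot x (leavesOf ts)
  → mergeStep Γ ts ≡ nothing → GreedyOutcome Γ x ts
stuck-forest-outcome []             f            r _     = empty (rot-[] r)
stuck-forest-outcome (t ∷ [])       (a ∷ [] , _) r _     = planar t a (subst (Rot _) (++-identityʳ (leaves t)) r)
stuck-forest-outcome (t₁ ∷ t₂ ∷ ts) f            r stuck =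
  cycle t₁ t₂ ts (stuck-forest-blockCycle (t₁ ∷ t₂ ∷ ts) f (s≤s (s≤s z≤n)) stuck) r

leavesOf-leaf : (x : List ℕ) → leavesOf (map leaf x) ≡ x
leavesOf-leaf []      = refl
leavesOf-leaf (v ∷ x) = cong (v ∷_) (leavesOf-leaf x)

leaf-admissible : {Γ : Graph} (x : List ℕ) → Sub x (V Γ) → All (Admissible Γ) (map leaf x)
leaf-admissible []      s = []
leaf-admissible (v ∷ x) s = singleton-tube (s v (here refl)) ∷ leaf-admissible x (λ y m → s y (there m))

leaf-forest : {Γ : Graph} (x : List ℕ) → Unique x → Sub x (V Γ) → Forest Γ (map leaf x)
leaf-forest {Γ} x u s =
  leaf-admissible x s , subst Unique (sym (leavesOf-leaf x)) u , subst (λ z → Sub z (V Γ)) (sym (leavesOf-leaf x)) s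

greedy-outcome : (Γ : Graph) (x : List ℕ) → Symmetric Γ → Unique x → Sub x (V Γ) → GreedyOutcome Γ x (greedy Γ x)
greedy-outcome Γ x sy u s =
  stuck-forest-outcome (greedy Γ x) (proj₁ run) (subst (λ z → Rot z (leavesOf (greedy Γ x))) (leavesOf-leaf x) (proj₂ run)) stuck
  where
  run = mergeLoop-forest Γ (length x) (map leaf x) sy (leaf-forest x u s)
  stuck : mergeStep Γ (greedy Γ x) ≡ nothing
  stuck = mergeLoop-stuck Γ (length x) (map leaf x)
    (subst (_≤ suc (length x)) (sym (length-map leaf x)) (n≤1+n _))


-- A basis element (bs , w) of CycHam‾ ∘ PlanEq consists of the blocks bs, each in its planar
-- order, and a cycle w through their labels minL b.
asComp : List (List ℕ) → List (List ℕ) × List ℕ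
asComp cs = cs , map minL cs

compBlocks : List (List ℕ) × List ℕ → List (List ℕ)
compBlocks (bs , w) = map (blockOrSelf bs) w

compBlocks-asComp : (cs : List (List ℕ)) → Unique (map minL cs) → compBlocks (asComp cs) ≡ cs
compBlocks-asComp cs u = ≡trans (sym (map-∘ cs)) (≡trans
  (map-cong-∈ cs (λ B m → blockOrSelf-just {cs} {minL B} (blockOf-minL u m))) (map-id cs))

contractP-adj : (Γ : Graph) (cs : List (List ℕ)) {B B' : List ℕ} → Unique (map minL cs) → B ∈ cs → B' ∈ cs
  → adj (contractP Γ cs) (minL B) (minL B') ≡ (not (minL B == minL B') ∧ edgeBetween Γ B B')
contractP-adj Γ cs {B} {B'} u m m' = cong₂ (λ X Y → not (minL B == minL B') ∧ edgeBetween Γ X Y)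
  (blockOrSelf-just {cs} {minL B} (blockOf-minL u m)) (blockOrSelf-just {cs} {minL B'} (blockOf-minL u m'))

blockCycle-ham : {Γ : Graph} {cs : List (List ℕ)} → BlockCycle Γ cs
  → All (λ p → adj (contractP Γ cs) (proj₁ p) (proj₂ p) ≡ false) (cycPairs (map minL cs))
blockCycle-ham {Γ} {cs} ch
  with cs | BlockCycle.atLeastTwo ch | BlockCycle.noEdge-consecutive ch | BlockCycle.noEdge-wrap ch
     | BlockCycle.distinct ch | blockCycle-nonEmpty ch
... | C₀ ∷ C₁ ∷ rest | _ | ncons | nwrap | U | NE =
  zip-All (minL C₀) (map minL (C₁ ∷ rest)) (minL C₀) consecutive wrap
  where
  cs' = C₀ ∷ C₁ ∷ rest
  labels-unique = minL-blocks-unique cs' NE U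
  consecutive : ∀ P' a b Q → minL C₀ ∷ map minL (C₁ ∷ rest) ≡ P' ++ a ∷ b ∷ Q → adj (contractP Γ cs') a b ≡ false
  consecutive P' a b Q e with map-consecutive minL cs' P' e
  ... | P'' , Q'' , B , B' , eq , refl , refl
    rewrite contractP-adj Γ cs' labels-unique (subst (B ∈_) (sym eq) (∈-middle P'')) (subst (B' ∈_) (sym eq) (∈-++⁺ʳ P'' (there (here refl))))
          | NoEdge⇒edgeBetween≡false Γ (ncons P'' B B' Q'' eq) = ∧-zeroʳ _
  wrap : ∀ m a → minL C₀ ∷ map minL (C₁ ∷ rest) ≡ m ++ [ a ] → adj (contractP Γ cs') a (minL C₀) ≡ false
  wrap m a e with ∃-init-last {xs = C₁ ∷ rest} (λ ())
  ... | m' , B , eq with map-∷ʳ minL cs' m (λ ()) e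
  ... | m'' , B₂ , eq2 , refl with ∷ʳ-injective m'' (C₀ ∷ m') (≡trans (sym eq2) (cong (C₀ ∷_) eq))
  ... | _ , refl
    rewrite contractP-adj Γ cs' labels-unique (subst (B₂ ∈_) (sym eq2) (∈-++⁺ʳ m'' (here refl))) (here {xs = C₁ ∷ rest} refl)
          | NoEdge⇒edgeBetween≡false Γ (nwrap B₂ C₀ m' (cong (C₀ ∷_) eq)) = ∧-zeroʳ _
... | [] | () | _ | _ | _ | _
... | _ ∷ [] | s≤s () | _ | _ | _ | _

ham-NoEdge : (Γ : Graph) (bs : List (List ℕ)) (w : List ℕ)
  → All (λ p → adj (contractP Γ bs) (proj₁ p) (proj₂ p) ≡ false) (cycPairs w)
  → ∀ a b → a ≢ b → (a , b) ∈ cycPairs w → NoEdge Γ (blockOrSelf bs a) (blockOrSelf bs b)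
ham-NoEdge Γ bs w ham a b ne m =
  edgeBetween≡false⇒NoEdge Γ
    (subst (λ z → z ∧ edgeBetween Γ (blockOrSelf bs a) (blockOrSelf bs b) ≡ false) (cong not (==-ne ne)) (All.lookup ham m))

module FromHamComp {Γ : Graph} (V-unique : Unique (V Γ)) {bs : List (List ℕ)} {w : List ℕ}
  (bs↭V : concat bs ↭ V Γ) (bs-planar : All (λ b → Tube Γ b × PlanEqB (restrict Γ b) b) bs)
  (w-ham : HamB (contractP Γ bs) w) where

  blocks-distinct : Unique (concat bs)
  blocks-distinct = unique-resp-↭ (↭-sym bs↭V) V-unique
  blocks-nonEmpty : All NonEmpty bs
  blocks-nonEmpty = All.map (λ p → proj₁ (proj₁ p)) bs-planar
  labels-unique : Unique (map minL bs)
  labels-unique = minL-blocks-unique bs blocks-nonEmpty blocks-distinct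
  w↭labels : w ↭ map minL bs
  w↭labels = proj₁ w-ham
  w-unique : Unique w
  w-unique = unique-resp-↭ (↭-sym w↭labels) labels-unique
  blockAt = blockOrSelf bs
  cycleBlocks = map blockAt w
  cycleBlocks↭bs : cycleBlocks ↭ bs
  cycleBlocks↭bs = subst (cycleBlocks ↭_) (compBlocks-asComp bs labels-unique) (map⁺ blockAt w↭labels)
  blockAt-label : ∀ a → a ∈ w → blockAt a ∈ bs × minL (blockAt a) ≡ a
  blockAt-label a m with ∈-map⁻ minL (∈-resp-↭ w↭labels m)
  ... | B , mB , refl = subst (_∈ bs) (sym (blockOrSelf-just {bs} {minL B} (blockOf-minL labels-unique mB))) mB ,
                        cong minL (blockOrSelf-just {bs} {minL B} (blockOf-minL labels-unique mB))
  labels-cycleBlocks : map minL cycleBlocks ≡ w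
  labels-cycleBlocks = ≡trans (sym (map-∘ w)) (≡trans (map-cong-∈ w (λ a m → proj₂ (blockAt-label a m))) (map-id w))

  blockCycle : BlockCycle Γ cycleBlocks
  blockCycle = record
    { atLeastTwo = subst (2 ≤_) (sym (length-map blockAt w)) (proj₁ (proj₂ w-ham))
    ; distinct = unique-resp-↭ (↭-sym (concat-↭ cycleBlocks↭bs)) blocks-distinct
    ; planarBlocks = All.tabulate λ {B} mB → block-planar B (∈-resp-↭ cycleBlocks↭bs mB)
    ; noEdge-consecutive = consecutive
    ; noEdge-wrap = wrap }
    where
    block-planar : ∀ B → B ∈ bs → Σ PTree λ t → Admissible Γ t × leaves t ≡ B
    block-planar B mB with All.lookup bs-planar mB
    ... | tb , _ , t , ad , leq =
      t , admissible-transport t (λ _ _ → refl) (λ x m → proj₁ (proj₂ (proj₂ tb)) x (subst (x ∈_) leq m)) ad , leq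
    consecutive : ∀ P B B' Q → cycleBlocks ≡ P ++ B ∷ B' ∷ Q → NoEdge Γ B B'
    consecutive P B B' Q e with map-consecutive blockAt w P e
    ... | P'' , Q'' , a , b , eq , refl , refl =
      ham-NoEdge Γ bs w (proj₂ (proj₂ w-ham)) a b
        (unique-consecutive-≢ P'' (subst Unique eq w-unique)) (cycPairs-consecutive w P'' eq)
    wrap : ∀ B B' m → cycleBlocks ≡ B' ∷ m ++ [ B ] → NoEdge Γ B B'
    wrap B B' m e with map-wrap blockAt w e
    ... | x , xs , m' , a , refl , eq2 , refl , refl =
      ham-NoEdge Γ bs w (proj₂ (proj₂ w-ham)) a x
        (unique-wrap-≢ x m' (subst (λ z → Unique (x ∷ z)) eq2 w-unique)) (cycPairs-wrap x xs m' eq2)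

  asComp-eqv : (isPermL bs (proj₁ (asComp cycleBlocks)) ∧ rotEq w (proj₂ (asComp cycleBlocks))) ≡ true
  asComp-eqv = ∧≡true⁺ (isPermL-complete bs cycleBlocks (↭-sym cycleBlocks↭bs))
    (subst (λ z → rotEq w z ≡ true) (sym labels-cycleBlocks) (rotEq-refl w))


SumModule : BasedModule
SumModule = CycEqM ⊕M HamCompM

Sum : Set
Sum = BasedModule.R SumModule

eqvSum : Sum → Sum → Bool
eqvSum = BasedModule.eqv SumModule

relabelSum : (ℕ → ℕ) → Sum → Sum
relabelSum = BasedModule.relabel SumModule

actSum : List ℕ → List ℕ → Sum → Sum
actSum = BasedModule.act SumModule

-- The first clause is junk: greedy merging returns [] only on the empty word.
classify : List ℕ → List PTree → Sum
classify x [] = inj₂ ([] , [])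
classify x (t ∷ []) = inj₁ x
classify x (t₁ ∷ t₂ ∷ ts) = inj₂ (asComp (map leaves (t₁ ∷ t₂ ∷ ts)))

flatten : Sum → List ℕ
flatten (inj₁ s) = s
flatten (inj₂ D) = concat (compBlocks D)

eqvSum-coh : {y y' : Sum} → eqvSum y y' ≡ true → ∀ r → eqvSum y r ≡ eqvSum y' r
eqvSum-coh {inj₁ s} {inj₁ s'} e (inj₁ r) = rotEq-coh {s} {s'} e r
eqvSum-coh {inj₁ s} {inj₁ s'} e (inj₂ r) = refl
eqvSum-coh {inj₂ (bs , w)} {inj₂ (bs' , w')} e (inj₁ r) = refl
eqvSum-coh {inj₂ (bs , w)} {inj₂ (bs' , w')} e (inj₂ (rb , rw)) =
  cong₂ _∧_ (isPermL-coh {bs} {bs'} (proj₁ e′) rb) (rotEq-coh {w} {w'} (proj₂ e′) rw)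
  where
  e′ = ∧≡true⁻ {isPermL bs bs'} {rotEq w w'} e
eqvSum-coh {inj₁ _} {inj₂ _} () r
eqvSum-coh {inj₂ _} {inj₁ _} () r

eqvSum-refl : (y : Sum) → eqvSum y y ≡ true
eqvSum-refl (inj₁ s) = rotEq-refl s
eqvSum-refl (inj₂ (bs , w)) = ∧≡true⁺ (isPermL-complete bs bs ↭-refl) (rotEq-refl w)

eqvSum-sym : {y y' : Sum} → eqvSum y y' ≡ true → eqvSum y' y ≡ true
eqvSum-sym {y} {y'} e = ≡trans (sym (eqvSum-coh {y} {y'} e y)) (eqvSum-refl y)

eqvSum-trans : {y y' y'' : Sum} → eqvSum y y' ≡ true → eqvSum y' y'' ≡ true → eqvSum y y'' ≡ true
eqvSum-trans {y} {y'} {y''} e1 e2 = ≡trans (eqvSum-coh {y} {y'} e1 y'') e2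

rot⇒eqvSum : {cs ds : List (List ℕ)} → Rot′ cs ds → eqvSum (inj₂ (asComp cs)) (inj₂ (asComp ds)) ≡ true
rot⇒eqvSum {cs} {ds} r = ∧≡true⁺ (isPermL-complete cs ds (rot⇒↭ r)) (rotEq-complete (rot-map minL r))

blockCycle-minL-unique : {Γ : Graph} {cs : List (List ℕ)} → BlockCycle Γ cs → Unique (map minL cs)
blockCycle-minL-unique ch = minL-blocks-unique _ (blockCycle-nonEmpty ch) (BlockCycle.distinct ch)

eqvSum⇒rot : {Γ : Graph} {cs ds : List (List ℕ)} → BlockCycle Γ cs → BlockCycle Γ ds
  → eqvSum (inj₂ (asComp cs)) (inj₂ (asComp ds)) ≡ true → Rot′ cs ds
eqvSum⇒rot {Γ} {cs} {ds} chc chd e =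
  subst₂ Rot′ (compBlocks-asComp cs (blockCycle-minL-unique chc)) eqd
    (rot-map (blockOrSelf cs) (rotEq-sound {map minL cs} {map minL ds} (proj₂ e′)))
  where
  p : cs ↭ ds
  e′ = ∧≡true⁻ {isPermL cs ds} {rotEq (map minL cs) (map minL ds)} e
  p = isPermL-sound cs ds (proj₁ e′)
  eqd : map (blockOrSelf cs) (map minL ds) ≡ ds
  eqd = ≡trans (sym (map-∘ ds)) (≡trans
    (map-cong-∈ ds (λ B m → blockOrSelf-just {cs} {minL B} (blockOf-minL (blockCycle-minL-unique chc) (∈-resp-↭ (↭-sym p) m))))
    (map-id ds))

Represents : Graph → List ℕ → Sum → Set
Represents Γ x (inj₁ s) = Rot x s × Σ PTree (λ t → Admissible Γ t × Rot x (leaves t))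
Represents Γ x (inj₂ D) =
  Rot x (concat (compBlocks D)) × BlockCycle Γ (compBlocks D) × eqvSum (inj₂ D) (inj₂ (asComp (compBlocks D))) ≡ true

represents-rot : {Γ : Graph} {x : List ℕ} (y : Sum) → Represents Γ x y → Rot x (flatten y)
represents-rot (inj₁ s) r = proj₁ r
represents-rot (inj₂ D) r = proj₁ r

-- Planar words and block cycles exclude each other (blockCycle-not-planar), and a block cycle
-- is unique up to rotation (blockCycle-unique).
represents-unique : {Γ : Graph} {x x' : List ℕ} (y y' : Sum) → Represents Γ x y → Represents Γ x' y'
  → Rot x x' → eqvSum y y' ≡ true
represents-unique (inj₁ s) (inj₁ s') (rs , _) (rs' , _) r = rotEq-complete (rot-trans (rot-sym rs) (rot-trans r rs'))
represents-unique (inj₁ s) (inj₂ D') (rs , t , ad , rt) (rD' , ch' , _) r =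
  ⊥-elim (blockCycle-not-planar ch' t ad (rot-trans (rot-sym rD') (rot-trans (rot-sym r) rt)))
represents-unique (inj₂ D) (inj₁ s') (rD , ch , _) (rs' , t , ad , rt) r =
  ⊥-elim (blockCycle-not-planar ch t ad (rot-trans (rot-sym rD) (rot-trans r rt)))
represents-unique (inj₂ D) (inj₂ D') (rD , ch , e) (rD' , ch' , e') r =
  eqvSum-trans {inj₂ D} {inj₂ (asComp (compBlocks D))} {inj₂ D'} e (eqvSum-trans {inj₂ (asComp (compBlocks D))} {inj₂ (asComp (compBlocks D'))} {inj₂ D'}
    (rot⇒eqvSum (blockCycle-unique ch ch' (rot-trans (rot-sym rD) (rot-trans r rD'))))
    (eqvSum-sym {inj₂ D'} {inj₂ (asComp (compBlocks D'))} e'))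

represents-flatten-rot : {Γ : Graph} (y y' : Sum) → Represents Γ (flatten y) y
  → Represents Γ (flatten y') y' → eqvSum y y' ≡ true → Rot (flatten y) (flatten y')
represents-flatten-rot (inj₁ s) (inj₁ s') _ _ e = rotEq-sound {s} {s'} e
represents-flatten-rot (inj₂ D) (inj₂ D') (_ , ch , e1) (_ , ch' , e2) e =
  rot-concat (eqvSum⇒rot ch ch' (eqvSum-trans {inj₂ (asComp (compBlocks D))} {inj₂ D} {inj₂ (asComp (compBlocks D'))}
    (eqvSum-sym {inj₂ D} {inj₂ (asComp (compBlocks D))} e1) (eqvSum-trans {inj₂ D} {inj₂ D'} {inj₂ (asComp (compBlocks D'))} e e2)))
represents-flatten-rot (inj₁ _) (inj₂ _) _ _ ()
represents-flatten-rot (inj₂ _) (inj₁ _) _ _ ()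

classify-represents : {Γ : Graph} {x : List ℕ} (ts : List PTree) → GreedyOutcome Γ x ts → NonEmpty x
  → Represents Γ x (classify x ts)
classify-represents [] (empty e) ne = ⊥-elim (ne e)
classify-represents (t ∷ []) (planar .t ad r) ne = rot-refl _ , t , ad , r
classify-represents {Γ} {x} (t₁ ∷ t₂ ∷ ts) (cycle .t₁ .t₂ .ts ch r) ne =
  subst (λ z → Rot x (concat z) × BlockCycle Γ z × eqvSum (inj₂ (asComp cs)) (inj₂ (asComp z)) ≡ true)
    (sym (compBlocks-asComp cs (blockCycle-minL-unique ch))) (r , ch , eqvSum-refl (inj₂ (asComp cs)))
  where
  cs = map leaves (t₁ ∷ t₂ ∷ ts)

ValidPerm : Graph → List ℕ → Set
ValidPerm Γ x = x ↭ V Γ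

ValidSum : Graph → Sum → Set
ValidSum = BasedModule.valid SumModule

decompose : Graph → List ℕ → Sum
decompose Γ x = classify x (greedy Γ x)

greedy-outcome-valid : {Γ : Graph} → CGraph Γ → {x : List ℕ} → ValidPerm Γ x → GreedyOutcome Γ x (greedy Γ x)
greedy-outcome-valid {Γ} cg {x} vx =
  greedy-outcome Γ x (CGraph-symmetric cg) (unique-resp-↭ (↭-sym vx) (CGraph-unique cg)) (λ z m → ∈-resp-↭ vx m)

decompose-represents : {Γ : Graph} → CGraph Γ → {x : List ℕ} → ValidPerm Γ x → Represents Γ x (decompose Γ x)
decompose-represents {Γ} cg {x} vx =
  classify-represents (greedy Γ x) (greedy-outcome-valid cg vx) (↭-nonEmpty vx (CGraph-nonEmpty cg))

flatten-represents : {Γ : Graph} → CGraph Γ → (y : Sum) → ValidSum Γ y → Represents Γ (flatten y) y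
flatten-represents cg (inj₁ s) (_ , r , rs , _ , t , ad , refl) = rot-refl s , t , ad , rs
flatten-represents cg (inj₂ (bs , w)) (pc , al , hb) = rot-refl _ , blockCycle , asComp-eqv
  where open FromHamComp (CGraph-unique cg) pc al hb

classify-valid : {Γ : Graph} {x : List ℕ} (ts : List PTree) → GreedyOutcome Γ x ts → NonEmpty x
  → ValidPerm Γ x → ValidSum Γ (classify x ts)
classify-valid [] (empty e) ne _ = ⊥-elim (ne e)
classify-valid (t ∷ []) (planar .t ad r) ne vx = vx , leaves t , r , ↭-trans (↭-sym (rot⇒↭ r)) vx , t , ad , refl
classify-valid {Γ} {x} (t₁ ∷ t₂ ∷ ts) (cycle .t₁ .t₂ .ts ch r) ne vx =
  ↭-trans (↭-sym (rot⇒↭ r)) vx ,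
  All.map (λ { (t , ad , refl) → admissible⇒tube t ad , ↭-refl , t , admissible-transport t (λ _ _ → refl) (λ z m → m) ad , refl })
    (BlockCycle.planarBlocks ch) ,
  ↭-refl , subst (2 ≤_) (sym (length-map minL cs)) (BlockCycle.atLeastTwo ch) , blockCycle-ham ch
  where
  cs = map leaves (t₁ ∷ t₂ ∷ ts)

decompose-valid : {Γ : Graph} → CGraph Γ → {x : List ℕ} → ValidPerm Γ x → ValidSum Γ (decompose Γ x)
decompose-valid {Γ} cg {x} vx =
  classify-valid (greedy Γ x) (greedy-outcome-valid cg vx) (↭-nonEmpty vx (CGraph-nonEmpty cg)) vx

flatten-valid : {Γ : Graph} → CGraph Γ → (y : Sum) → ValidSum Γ y → ValidPerm Γ (flatten y)
flatten-valid cg (inj₁ s) v = proj₁ v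
flatten-valid cg (inj₂ (bs , w)) (pc , al , hb) = ↭-trans (concat-↭ (FromHamComp.cycleBlocks↭bs (CGraph-unique cg) pc al hb)) pc


relabelTree : (ℕ → ℕ) → PTree → PTree
relabelTree σ (leaf v) = leaf (σ v)
relabelTree σ (node l r) = node (relabelTree σ l) (relabelTree σ r)

leaves-relabelTree : (σ : ℕ → ℕ) (t : PTree) → leaves (relabelTree σ t) ≡ map σ (leaves t)
leaves-relabelTree σ (leaf v) = refl
leaves-relabelTree σ (node l r) =
  ≡trans (cong₂ _++_ (leaves-relabelTree σ l) (leaves-relabelTree σ r)) (sym (map-++ σ (leaves l) (leaves r)))

leavesOf-relabelTree : (σ : ℕ → ℕ) (ts : List PTree) → leavesOf (map (relabelTree σ) ts) ≡ map σ (leavesOf ts)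
leavesOf-relabelTree σ [] = refl
leavesOf-relabelTree σ (t ∷ ts) =
  ≡trans (cong₂ _++_ (leaves-relabelTree σ t) (leavesOf-relabelTree σ ts)) (sym (map-++ σ (leaves t) (leavesOf ts)))

module Relabel {Γ Γ' : Graph} (σ : ℕ → ℕ) (iso : ∀ u v → u ∈ V Γ → v ∈ V Γ → adj Γ' (σ u) (σ v) ≡ adj Γ u v) where

  anyσ : (x : ℕ) → x ∈ V Γ → (L : List ℕ) → Sub L (V Γ) → any (λ w → adj Γ' (σ x) w) (map σ L) ≡ any (λ w → adj Γ x w) L
  anyσ x mx [] s = refl
  anyσ x mx (y ∷ L) s = cong₂ _∨_ (iso x y mx (s y (here refl))) (anyσ x mx L (λ z m → s z (there m)))

  edgeBetweenσ : (L₁ L₂ : List ℕ) → Sub L₁ (V Γ) → Sub L₂ (V Γ)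
    → edgeBetween Γ' (map σ L₁) (map σ L₂) ≡ edgeBetween Γ L₁ L₂
  edgeBetweenσ [] L₂ s1 s2 = refl
  edgeBetweenσ (x ∷ L₁) L₂ s1 s2 = cong₂ _∨_ (anyσ x (s1 x (here refl)) L₂ s2) (edgeBetweenσ L₁ L₂ (λ z m → s1 z (there m)) s2)

  treesAdjacentσ : (t₁ t₂ : PTree) → Sub (leaves t₁) (V Γ) → Sub (leaves t₂) (V Γ)
    → treesAdjacent Γ' (relabelTree σ t₁) (relabelTree σ t₂) ≡ treesAdjacent Γ t₁ t₂
  treesAdjacentσ t₁ t₂ s1 s2 rewrite leaves-relabelTree σ t₁ | leaves-relabelTree σ t₂ = edgeBetweenσ (leaves t₁) (leaves t₂) s1 s2

  mergeFirstσ : (ts : List PTree) → Sub (leavesOf ts) (V Γ)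
    → mergeFirst Γ' (map (relabelTree σ) ts) ≡ Maybe.map (map (relabelTree σ)) (mergeFirst Γ ts)
  mergeFirstσ [] s = refl
  mergeFirstσ (t ∷ []) s = refl
  mergeFirstσ (t₁ ∷ t₂ ∷ ts) s
    with treesAdjacent Γ' (relabelTree σ t₁) (relabelTree σ t₂) | treesAdjacent Γ t₁ t₂
       | treesAdjacentσ t₁ t₂ (λ z m → s z (∈-++⁺ˡ m)) (λ z m → s z (∈-++⁺ʳ (leaves t₁) (∈-++⁺ˡ m)))
       | mergeFirstσ (t₂ ∷ ts) (λ z m → s z (∈-++⁺ʳ (leaves t₁) m))
  ... | true | true | refl | _ = refl
  ... | true | false | () | _
  ... | false | true | () | _
  ... | false | false | refl | ih rewrite ih with mergeFirst Γ (t₂ ∷ ts)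
  ... | just _ = refl
  ... | nothing = refl

  rotateσ : (ts : List PTree) → rotate (map (relabelTree σ) ts) ≡ map (relabelTree σ) (rotate ts)
  rotateσ [] = refl
  rotateσ (t ∷ ts) = sym (map-++ (relabelTree σ) ts [ t ])

  mergeStepσ : (ts : List PTree) → Sub (leavesOf ts) (V Γ)
    → mergeStep Γ' (map (relabelTree σ) ts) ≡ Maybe.map (map (relabelTree σ)) (mergeStep Γ ts)
  mergeStepσ ts s rewrite mergeFirstσ ts s with mergeFirst Γ ts
  ... | just _  = refl
  ... | nothing rewrite rotateσ ts = mergeFirstσ (rotate ts) (Sub-resp-rot (leavesOf-rot (rotate-rot ts)) s)

  mergeLoopσ : (n : ℕ) (ts : List PTree) → Sub (leavesOf ts) (V Γ)
    → mergeLoop Γ' n (map (relabelTree σ) ts) ≡ map (relabelTree σ) (mergeLoop Γ n ts)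
  mergeLoopσ zero    ts s = refl
  mergeLoopσ (suc n) ts s rewrite mergeStepσ ts s with mergeStep Γ ts in e
  ... | just ts' = mergeLoopσ n ts' (Sub-resp-rot (mergeStep-rot Γ ts e) s)
  ... | nothing  = refl

  greedyσ : (x : List ℕ) → Sub x (V Γ) → greedy Γ' (map σ x) ≡ map (relabelTree σ) (greedy Γ x)
  greedyσ x s rewrite length-map σ x
                    | sym (map-∘ {g = leaf} {f = σ} x)
                    | map-∘ {g = relabelTree σ} {f = leaf} x
    = mergeLoopσ (length x) (map leaf x) (subst (λ z → Sub z (V Γ)) (sym (leavesOf-leaf x)) s)

  classifyσ : (x : List ℕ) (ts : List PTree) → GreedyOutcome Γ x ts
    → classify (map σ x) (map (relabelTree σ) ts) ≡ relabelSum σ (classify x ts)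
  classifyσ x [] _ = refl
  classifyσ x (t ∷ []) _ = refl
  classifyσ x (t₁ ∷ t₂ ∷ ts) (cycle .t₁ .t₂ .ts ch r) =
    cong inj₂ (cong₂ _,_ e1 (≡trans (cong (map minL) e1) (≡trans (sym (map-∘ cs))
       (≡trans (map-cong-∈ cs (λ B m → sym (blockRelabel-just σ {cs} {minL B} {B} (blockOf-minL (blockCycle-minL-unique ch) m)))) (map-∘ cs)))))
    where
    cs = map leaves (t₁ ∷ t₂ ∷ ts)
    e1 : map leaves (map (relabelTree σ) (t₁ ∷ t₂ ∷ ts)) ≡ map (map σ) cs
    e1 = ≡trans (sym (map-∘ (t₁ ∷ t₂ ∷ ts))) (≡trans (map-cong-∈ (t₁ ∷ t₂ ∷ ts) (λ t _ → leaves-relabelTree σ t))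
           (map-∘ (t₁ ∷ t₂ ∷ ts)))


substAt-rot : (m : ℕ) (q : List ℕ) {L L' : List ℕ} → Rot L L' → Rot (substAt m q L) (substAt m q L')
substAt-rot m q (a , b , refl , refl) = substAt m q a , substAt m q b , concatMap-++ _ a b , concatMap-++ _ b a

substAt-concat : (m : ℕ) (q : List ℕ) (cs : List (List ℕ)) → substAt m q (concat cs) ≡ concat (map (substAt m q) cs)
substAt-concat m q [] = refl
substAt-concat m q (c ∷ cs) = ≡trans (concatMap-++ _ c (concat cs)) (cong (substAt m q c ++_) (substAt-concat m q cs))

-- Substitution of the planar sequence p of the tube G for the vertex {G} of Γ/G, which is
-- labelled mG; π is the quotient map V_Γ → V_{Γ/G}.
module Substitution {Γ : Graph} (cg : CGraph Γ) {G : List ℕ} (tG : Tube Γ G) {p : List ℕ}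
  (pE : PlanEqB (restrict Γ G) p) where

  pG : p ↭ G
  pG = proj₁ pE
  Tp : PTree
  Tp = proj₁ (proj₂ pE)
  lTp : leaves Tp ≡ p
  lTp = proj₂ (proj₂ (proj₂ pE))
  aTp : Admissible Γ Tp
  aTp = admissible-transport Tp (λ _ _ → refl)
    (λ z m → proj₁ (proj₂ (proj₂ tG)) z (∈-resp-↭ pG (subst (z ∈_) lTp m))) (proj₁ (proj₂ (proj₂ pE)))

  mG : ℕ
  mG = minL G
  R : List ℕ
  R = filterᵇ (λ v → not (v ∈ᵇ G)) (V Γ)
  I : List (List ℕ)
  I = G ∷ map [_] R
  ΓG : Graph
  ΓG = contract Γ G
  S : List ℕ → List ℕ
  S = substAt mG p

  π : ℕ → ℕ
  π u = if u ∈ᵇ G then mG else u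

  mG∈G : mG ∈ G
  mG∈G = minL-∈ (proj₁ tG)
  G⊆V : Sub G (V Γ)
  G⊆V = proj₁ (proj₂ (proj₂ tG))
  UG : Unique G
  UG = proj₁ (proj₂ tG)
  p→G : ∀ {u} → u ∈ p → u ∈ G
  p→G m = ∈-resp-↭ pG m
  G→p : ∀ {u} → u ∈ G → u ∈ p
  G→p m = ∈-resp-↭ (↭-sym pG) m
  Up : Unique p
  Up = unique-resp-↭ (↭-sym pG) UG
  pne : NonEmpty p
  pne = ↭-nonEmpty pG (proj₁ tG)

  VΓG : V ΓG ≡ mG ∷ R
  VΓG = cong (mG ∷_) (minL-singletons R)

  ∈-VΓG : ∀ {v} → v ∈ V ΓG → v ≡ mG ⊎ (v ∈ V Γ × v ∉ G)
  ∈-VΓG {v} m with subst (v ∈_) VΓG m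
  ... | here e = inj₁ e
  ... | there mR with ∈-filterᵇ⁻ (λ v → not (v ∈ᵇ G)) (V Γ) mR
  ... | mV , e = inj₂ (mV , λ mg → not≡true⇒≢true e (∈⇒∈ᵇ mg))

  ∈-VΓG-other : ∀ {v} → v ∈ V ΓG → v ≢ mG → v ∈ V Γ × v ∉ G
  ∈-VΓG-other m ne with ∈-VΓG m
  ... | inj₁ e = ⊥-elim (ne e)
  ... | inj₂ r = r

  VΓG-unique : Unique (V ΓG)
  VΓG-unique = subst Unique (sym VΓG)
    (All.tabulate (λ {v} m e → not≡true⇒≢true (proj₂ (∈-filterᵇ⁻ (λ v → not (v ∈ᵇ G)) (V Γ) m)) (∈⇒∈ᵇ (subst (_∈ G) e mG∈G)))
     ∷ filterᵇ-unique _ (V Γ) (CGraph-unique cg))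

  block : ℕ → List ℕ
  block a = blockOrSelf I a

  block-mG : block mG ≡ G
  block-mG = blockOrSelf-just {I} {mG} (subst (λ z → (if z then just G else blockOf (map [_] R) mG) ≡ just G) (sym (==-refl mG)) refl)

  block-other : ∀ {a} → a ≢ mG → block a ≡ [ a ]
  block-other {a} ne with blockOf I a in e
  ... | nothing = refl
  ... | just B = ≡trans (sym (blockOrSelf-just {map [_] R} {a} e')) (blockOrSelf-singletons R a)
    where
    e' : blockOf (map [_] R) a ≡ just B
    e' = ≡trans (sym (cong (λ z → if z then just G else blockOf (map [_] R) a) (==-ne (λ q → ne (sym q))))) e

  π-cases : ∀ u → (u ∈ G × π u ≡ mG) ⊎ (u ∉ G × π u ≡ u)
  π-cases u with u ∈ᵇ G in e
  ... | true = inj₁ (∈ᵇ⇒∈ e , refl)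
  ... | false = inj₂ ((λ m → case ≡trans (sym e) (∈⇒∈ᵇ m) of λ ()) , refl)

  ∉G⇒≢mG : ∀ {u} → u ∉ G → u ≢ mG
  ∉G⇒≢mG nu e = nu (subst (_∈ G) (sym e) mG∈G)

  chunk : ℕ → List ℕ
  chunk y = if y == mG then p else [ y ]

  ∈-S⁻ : (L : List ℕ) {u : ℕ} → u ∈ S L → (u ∈ G × mG ∈ L) ⊎ (u ∈ L × u ≢ mG)
  ∈-S⁻ (y ∷ L) {u} m with ∈-++⁻ (chunk y) m
  ... | inj₂ m2 = ⊎-map (λ { (a , b) → a , there b }) (λ { (a , b) → there a , b }) (∈-S⁻ L m2)
  ... | inj₁ m1 with y == mG in e
  ... | true = inj₁ (p→G m1 , here (sym (==-sound e)))
  ∈-S⁻ (y ∷ L) {u} m | inj₁ (here refl) | false = inj₂ (here refl , ==-false e)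

  tube⊆S : (L : List ℕ) {u : ℕ} → mG ∈ L → u ∈ G → u ∈ S L
  tube⊆S (y ∷ L) (there m) mu = ∈-++⁺ʳ (chunk y) (tube⊆S L m mu)
  tube⊆S (y ∷ L) (here refl) mu rewrite ==-refl mG = ∈-++⁺ˡ (G→p mu)

  ∈-S⁺ : (L : List ℕ) {u : ℕ} → u ∈ L → u ≢ mG → u ∈ S L
  ∈-S⁺ (y ∷ L) (there m) ne = ∈-++⁺ʳ (chunk y) (∈-S⁺ L m ne)
  ∈-S⁺ (y ∷ L) (here refl) ne rewrite ==-ne ne = here refl

  π-∈ : {L : List ℕ} → Sub L (V ΓG) → ∀ {u} → u ∈ S L → π u ∈ L
  π-∈ {L} sub {u} m with ∈-S⁻ L m | π-cases u
  ... | inj₁ (_ , mL) | inj₁ (_ , e) = subst (_∈ L) (sym e) mL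
  ... | inj₁ (uG , _) | inj₂ (nG , _) = ⊥-elim (nG uG)
  ... | inj₂ (uL , ne) | inj₁ (uG , _) = ⊥-elim (proj₂ (∈-VΓG-other (sub u uL) ne) uG)
  ... | inj₂ (uL , ne) | inj₂ (_ , e) = subst (_∈ L) (sym e) uL

  S-Sub : {L : List ℕ} → Sub L (V ΓG) → Sub (S L) (V Γ)
  S-Sub {L} sub u m with ∈-S⁻ L m
  ... | inj₁ (uG , _) = G⊆V u uG
  ... | inj₂ (uL , ne) = proj₁ (∈-VΓG-other (sub u uL) ne)

  S-unique : (L : List ℕ) → Unique L → Sub L (V ΓG) → Unique (S L)
  S-unique [] _ _ = []
  S-unique (y ∷ L) (a ∷ u) sub with y == mG in e
  ... | true = Unique-++⁺ Up (S-unique L u (λ z m → sub z (there m))) dj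
    where
    dj : ∀ {v} → ¬ (v ∈ p × v ∈ S L)
    dj (vp , vS) with ∈-S⁻ L vS
    ... | inj₁ (_ , mL) = All.lookup a mL (==-sound e)
    ... | inj₂ (vL , ne) = proj₂ (∈-VΓG-other (sub _ (there vL)) ne) (p→G vp)
  ... | false = Unique-++⁺ ([] ∷ []) (S-unique L u (λ z m → sub z (there m))) dj
    where
    dj : ∀ {v} → ¬ (v ∈ [ y ] × v ∈ S L)
    dj (here refl , vS) with ∈-S⁻ L vS
    ... | inj₁ (vG , _) = proj₂ (∈-VΓG-other (sub _ (here refl)) (==-false e)) vG
    ... | inj₂ (vL , _) = All.lookup a vL refl

  S-nonEmpty : {L : List ℕ} → NonEmpty L → NonEmpty (S L)
  S-nonEmpty {[]} ne = ⊥-elim (ne refl)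
  S-nonEmpty {y ∷ L} _ with y == mG
  ... | true = ++-nonEmpty pne
  ... | false = λ ()

  ∈-block : {L : List ℕ} → Sub L (V ΓG) → ∀ {a α} → a ∈ L → α ∈ block a → α ∈ S L × π α ≡ a
  ∈-block {L} sub {a} {α} ma mα with a ≟ mG
  ... | yes refl = tube⊆S L ma αG , (case (π-cases α))
    where
    αG : α ∈ G
    αG = subst (α ∈_) block-mG mα
    case : _ → π α ≡ mG
    case (inj₁ (_ , e)) = e
    case (inj₂ (n , _)) = ⊥-elim (n αG)
  ... | no ne with subst (α ∈_) (block-other ne) mα
  ... | here refl = ∈-S⁺ L ma ne , case (π-cases α)
    where
    case : _ → π α ≡ α
    case (inj₁ (αG , _)) = ⊥-elim (proj₂ (∈-VΓG-other (sub α ma) ne) αG)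
    case (inj₂ (_ , e)) = e

  ∈-block-π : ∀ α → α ∈ block (π α)
  ∈-block-π α with π-cases α
  ... | inj₁ (αG , e) rewrite e = subst (α ∈_) (sym block-mG) αG
  ... | inj₂ (n , e) rewrite e = subst (α ∈_) (sym (block-other (∉G⇒≢mG n))) (here refl)

  π-path : {L : List ℕ} → Sub L (V ΓG) → ∀ {u v} → u ∈ S L → v ∈ S L → π u ≡ π v → PathIn Γ (S L) u v
  π-path {L} sub {u} {v} mu mv e with π-cases u | π-cases v
  ... | inj₁ (uG , _) | inj₁ (vG , _) with ∈-S⁻ L mu
  ...   | inj₁ (_ , mL) = path-mono (λ z m → tube⊆S L mL m) (proj₂ (proj₂ (proj₂ tG)) u v uG vG)
  ...   | inj₂ (uL , ne) = ⊥-elim (proj₂ (∈-VΓG-other (sub u uL) ne) uG)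
  π-path {L} sub {u} {v} mu mv e | inj₁ (uG , eu) | inj₂ (nv , ev) = ⊥-elim (nv (subst (_∈ G) (≡trans (sym eu) (≡trans e ev)) mG∈G))
  π-path {L} sub {u} {v} mu mv e | inj₂ (nu , eu) | inj₁ (vG , ev) = ⊥-elim (nu (subst (_∈ G) (≡trans (sym ev) (≡trans (sym e) eu)) mG∈G))
  π-path {L} sub {u} {v} mu mv e | inj₂ (_ , eu) | inj₂ (_ , ev) = subst (PathIn Γ (S L) u) (≡trans (sym eu) (≡trans e ev)) here

  path-lift : {L : List ℕ} → Sub L (V ΓG) → ∀ {a b} → PathIn ΓG L a b
    → ∀ u → u ∈ S L → π u ≡ a → ∀ v → v ∈ S L → π v ≡ b → PathIn Γ (S L) u v
  path-lift sub here u mu eu v mv ev = π-path sub mu mv (≡trans eu (sym ev))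
  path-lift {L} sub {a} (step {w = w} e mw rest) u mu eu v mv ev
    with edgeBetween≡true⇒edge Γ {block a} {block w} (proj₂ (∧≡true⁻ {not (a == w)} e))
  ... | α , β , mα , mβ , eαβ with ∈-block sub (subst (_∈ L) eu (π-∈ sub mu)) mα | ∈-block sub mw mβ
  ... | αS , πα | βS , πβ =
    path-trans (π-path sub mu αS (≡trans eu (sym πα))) (step eαβ βS (path-lift sub rest β βS πβ v mv ev))

  tube-lift : {L : List ℕ} → Tube ΓG L → Tube Γ (S L)
  tube-lift {L} (ne , U , sub , conn) =
    S-nonEmpty ne , S-unique L U sub , S-Sub sub ,
    λ u v mu mv → path-lift sub (conn (π u) (π v) (π-∈ sub mu) (π-∈ sub mv)) u mu refl v mv refl

  substTree : PTree → PTree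
  substTree (leaf v) = if v == mG then Tp else leaf v
  substTree (node l r) = node (substTree l) (substTree r)

  leaves-substTree : (t : PTree) → leaves (substTree t) ≡ S (leaves t)
  leaves-substTree (leaf v) with v == mG
  ... | true = ≡trans lTp (sym (++-identityʳ p))
  ... | false = refl
  leaves-substTree (node l r) = ≡trans (cong₂ _++_ (leaves-substTree l) (leaves-substTree r)) (sym (concatMap-++ _ (leaves l) (leaves r)))

  substTree-admissible : (t : PTree) → Admissible ΓG t → Admissible Γ (substTree t)
  substTree-admissible (leaf v) ad with v == mG in e
  ... | true = aTp
  ... | false = singleton-tube (proj₁ (∈-VΓG-other (proj₁ (proj₂ (proj₂ ad)) v (here refl)) (==-false e)))
  substTree-admissible (node l r) (tb , al , ar) =
    subst (Tube Γ) (sym (leaves-substTree (node l r))) (tube-lift tb) , substTree-admissible l al , substTree-admissible r ar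

  minL-S : {B : List ℕ} → Sub B (V ΓG) → NonEmpty B → minL (S B) ≡ minL B
  minL-S {B} sub ne = minL-char m0S le
    where
    m0 = minL B
    m0B : m0 ∈ B
    m0B = minL-∈ ne
    m0S : m0 ∈ S B
    m0S with m0 ≟ mG
    ... | yes e = tube⊆S B (subst (_∈ B) e m0B) (subst (_∈ G) (sym e) mG∈G)
    ... | no n = ∈-S⁺ B m0B n
    le : ∀ y → y ∈ S B → m0 ≤ y
    le y m with ∈-S⁻ B m
    ... | inj₁ (yG , mB) = ≤-trans (minL-≤ mB) (minL-≤ yG)
    ... | inj₂ (yB , _) = minL-≤ yB

  NoEdge-lift : {B B' : List ℕ} → Sub B (V ΓG) → Sub B' (V ΓG) → (∀ z → z ∈ B → z ∈ B' → ⊥)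
    → NoEdge ΓG B B' → NoEdge Γ (S B) (S B')
  NoEdge-lift {B} {B'} s s' dj ne α β mα mβ = ≢true⇒≡false h
    where
    h : adj Γ α β ≡ true → ⊥
    h e with ≡trans (sym (ne (π α) (π β) (π-∈ s mα) (π-∈ s' mβ)))
               (cong (λ z → not z ∧ edgeBetween Γ (block (π α)) (block (π β))) (==-ne (λ q → dj _ (π-∈ s mα) (subst (_∈ B') (sym q) (π-∈ s' mβ)))))
    ... | q = case ≡trans q (any≡true⁺ (λ u → any (λ w → adj Γ u w) (block (π β))) (∈-block-π α)
                               (any≡true⁺ (λ w → adj Γ α w) (∈-block-π β) e)) of λ ()

  ΓG-symmetric : Symmetric ΓG
  ΓG-symmetric a b = cong₂ (λ x y → not x ∧ y) (==-sym a b) (edgeBetween-sym Γ (CGraph-symmetric cg) (block a) (block b))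

  blockCycle-lift : {cs : List (List ℕ)} → BlockCycle ΓG cs → BlockCycle Γ (map S cs)
  blockCycle-lift {cs} ch = record
    { atLeastTwo = subst (2 ≤_) (sym (length-map S cs)) (BlockCycle.atLeastTwo ch)
    ; distinct = subst Unique (substAt-concat mG p cs) (S-unique (concat cs) (BlockCycle.distinct ch) subAll)
    ; planarBlocks = All-map⁺ (All.map (λ { (t , ad , refl) → substTree t , substTree-admissible t ad , leaves-substTree t })
                                        (BlockCycle.planarBlocks ch))
    ; noEdge-consecutive = nl
    ; noEdge-wrap = nw }
    where
    subB : ∀ {B} → B ∈ cs → Sub B (V ΓG)
    subB = blockCycle-block⊆V ch
    subAll : Sub (concat cs) (V ΓG)
    subAll z m with ∈-concat⁻′ cs m
    ... | B , zB , mB = subB mB z zB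
    nl : ∀ P B B' Q → map S cs ≡ P ++ B ∷ B' ∷ Q → NoEdge Γ B B'
    nl P B B' Q e with map-consecutive S cs P e
    ... | P'' , Q'' , B₀ , B₀' , eq , refl , refl =
      NoEdge-lift (subB m0) (subB m0') dj (BlockCycle.noEdge-consecutive ch P'' B₀ B₀' Q'' eq)
      where
      m0 : B₀ ∈ cs
      m0 = subst (B₀ ∈_) (sym eq) (∈-middle P'')
      m0' : B₀' ∈ cs
      m0' = subst (B₀' ∈_) (sym eq) (∈-++⁺ʳ P'' (there (here refl)))
      dj : ∀ z → z ∈ B₀ → z ∈ B₀' → ⊥
      dj = concat-consecutive-disjoint P'' (subst (λ z → Unique (concat z)) eq (BlockCycle.distinct ch))
    nw : ∀ B B' m → map S cs ≡ B' ∷ m ++ [ B ] → NoEdge Γ B B'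
    nw B B' m e with map-wrap S cs e
    ... | x₀ , xs , m' , a , eqc , eq2 , refl , refl =
      NoEdge-lift (subB ma) (subB mx) dj (BlockCycle.noEdge-wrap ch a x₀ m' (≡trans eqc (cong (x₀ ∷_) eq2)))
      where
      ma : a ∈ cs
      ma = subst (a ∈_) (sym eqc) (there (subst (a ∈_) (sym eq2) (∈-++⁺ʳ m' (here refl))))
      mx : x₀ ∈ cs
      mx = subst (x₀ ∈_) (sym eqc) (here refl)
      dj : ∀ z → z ∈ a → z ∈ x₀ → ⊥
      dj = concat-wrap-disjoint m' (subst (λ z → Unique (concat z)) (≡trans eqc (cong (x₀ ∷_) eq2)) (BlockCycle.distinct ch))

  act-represents : (x : List ℕ) → Unique x → Sub x (V ΓG) → NonEmpty x → (ts : List PTree) → GreedyOutcome ΓG x ts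
    → Represents Γ (S x) (actSum G p (classify x ts))
  act-represents x ux sx nx [] (empty e) = ⊥-elim (nx e)
  act-represents x ux sx nx (t ∷ []) (planar .t ad r) =
    rot-refl _ , substTree t , substTree-admissible t ad , subst (Rot (S x)) (sym (leaves-substTree t)) (substAt-rot mG p r)
  act-represents x ux sx nx (t₁ ∷ t₂ ∷ ts) (cycle .t₁ .t₂ .ts ch r) =
    subst (λ z → Represents Γ (S x) (inj₂ (map S cs , z))) mins
      (subst (λ z → Rot (S x) (concat z) × BlockCycle Γ z × eqvSum (inj₂ (asComp cs')) (inj₂ (asComp z)) ≡ true)
        (sym (compBlocks-asComp cs' (blockCycle-minL-unique ch'))) (rr , ch' , eqvSum-refl (inj₂ (asComp cs'))))
    where
    cs = map leaves (t₁ ∷ t₂ ∷ ts)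
    cs' = map S cs
    ch' : BlockCycle Γ cs'
    ch' = blockCycle-lift ch
    rr : Rot (S x) (concat cs')
    rr = subst (Rot (S x)) (substAt-concat mG p cs) (substAt-rot mG p r)
    mins : map minL cs' ≡ map minL cs
    mins = ≡trans (sym (map-∘ cs))
      (map-cong-∈ cs (λ B m → minL-S (blockCycle-block⊆V ch m) (All.lookup (blockCycle-nonEmpty ch) m)))


decompose-resp-rot : {Γ : Graph} → CGraph Γ → {x x' : List ℕ} → ValidPerm Γ x → ValidPerm Γ x' → Rot x x'
  → eqvSum (decompose Γ x) (decompose Γ x') ≡ true
decompose-resp-rot cg vx vx' = represents-unique _ _ (decompose-represents cg vx) (decompose-represents cg vx')

flatten-resp-eqv : {Γ : Graph} → CGraph Γ → (y y' : Sum) → ValidSum Γ y → ValidSum Γ y' → eqvSum y y' ≡ true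
  → Rot (flatten y) (flatten y')
flatten-resp-eqv cg y y' vy vy' = represents-flatten-rot y y' (flatten-represents cg y vy) (flatten-represents cg y' vy')

flatten-decompose : {Γ : Graph} → CGraph Γ → {x : List ℕ} → ValidPerm Γ x → Rot (flatten (decompose Γ x)) x
flatten-decompose cg vx = rot-sym (represents-rot _ (decompose-represents cg vx))

decompose-flatten : {Γ : Graph} → CGraph Γ → (y : Sum) → ValidSum Γ y → eqvSum (decompose Γ (flatten y)) y ≡ true
decompose-flatten cg y vy =
  represents-unique _ y (decompose-represents cg (flatten-valid cg y vy)) (flatten-represents cg y vy) (rot-refl _)

decompose-relabel : {Γ Γ' : Graph} {σ : ℕ → ℕ} → CGraph Γ → GraphIso Γ Γ' σ → {x : List ℕ} → ValidPerm Γ x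
  → decompose Γ' (map σ x) ≡ relabelSum σ (decompose Γ x)
decompose-relabel {Γ} {Γ'} {σ} cg (_ , iso) {x} vx = begin
  classify (map σ x) (greedy Γ' (map σ x))                    ≡⟨ cong (classify (map σ x)) (greedyσ x x⊆V) ⟩
  classify (map σ x) (map (relabelTree σ) (greedy Γ x))       ≡⟨ classifyσ x (greedy Γ x) (greedy-outcome-valid cg vx) ⟩
  relabelSum σ (decompose Γ x) ∎
  where
  open Relabel {Γ} {Γ'} σ iso
  open ≡-Reasoning
  x⊆V : Sub x (V Γ)
  x⊆V z m = ∈-resp-↭ vx m

-- Both sides represent the substituted word: one decomposes it directly, the other lifts the
-- decomposition over Γ/G by substituting inside its blocks.
decompose-act : {Γ : Graph} {G x p : List ℕ} → CGraph Γ → Tube Γ G → ValidPerm (contract Γ G) x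
  → PlanEqB (restrict Γ G) p
  → eqvSum (decompose Γ (substTube G p x)) (actSum G p (decompose (contract Γ G) x)) ≡ true
decompose-act {Γ} {G} {x} {p} cg tG vx pE =
  represents-unique (decompose Γ (S x)) (actSum G p (decompose (contract Γ G) x)) direct lifted (rot-refl _)
  where
  open Substitution cg tG pE
  ux : Unique x
  ux = unique-resp-↭ (↭-sym vx) VΓG-unique
  sx : Sub x (V (contract Γ G))
  sx z m = ∈-resp-↭ vx m
  nx : NonEmpty x
  nx = ↭-nonEmpty vx (λ ())
  direct : Represents Γ (S x) (decompose Γ (S x))
  direct = classify-represents (greedy Γ (S x))
    (greedy-outcome Γ (S x) (CGraph-symmetric cg) (S-unique x ux sx) (S-Sub sx)) (S-nonEmpty nx)
  lifted : Represents Γ (S x) (actSum G p (decompose (contract Γ G) x))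
  lifted = act-represents x ux sx nx (greedy (contract Γ G) x) (greedy-outcome (contract Γ G) x ΓG-symmetric ux sx)

module Iso {c ℓ : Level} (K : Field c ℓ) where
  open Field K using (Carrier; _≈_; _+_; _*_; 1#; *-identityˡ; +-congʳ) renaming (refl to ≈-refl)
  open Lin K

  singleton-VecEq : {R : Set} (e : R → R → Bool) {a a' : Carrier} (y y' : R) → a ≈ a' → (∀ r → e y r ≡ e y' r)
    → ∀ r → coeff e ((a , y) ∷ []) r ≈ coeff e ((a' , y') ∷ []) r
  singleton-VecEq e y y' a≈a' same r rewrite same r with e y' r
  ... | true  = +-congʳ a≈a'
  ... | false = ≈-refl

  toSum : Graph → List ℕ → FVec Sum
  toSum Γ x = (1# , decompose Γ x) ∷ []

  toPerm : Graph → Sum → FVec (List ℕ)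
  toPerm Γ y = (1# , flatten y) ∷ []

  isModuleIso : IsModuleIso CycPermM SumModule toSum toPerm
  isModuleIso =
      (λ Γ cg x vx → decompose-valid cg vx ∷ [])
    , (λ Γ cg y vy → flatten-valid cg y vy ∷ [])
    , (λ Γ cg x x' vx vx' x≈x' → sumVecEq (decompose Γ x) (decompose Γ x')
          (decompose-resp-rot cg vx vx' (rotEq-sound {x} {x'} (T⇒≡true x≈x'))))
    , (λ Γ cg y y' vy vy' y≈y' → permVecEq (flatten y) (flatten y')
          (rotEq-complete (flatten-resp-eqv cg y y' vy vy' (T⇒≡true y≈y'))))
    , (λ Γ cg x vx → singleton-VecEq rotEq (flatten (decompose Γ x)) x (*-identityˡ 1#)
          (rotEq-coh {flatten (decompose Γ x)} {x} (rotEq-complete (flatten-decompose cg vx))))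
    , (λ Γ cg y vy → singleton-VecEq eqvSum (decompose Γ (flatten y)) y (*-identityˡ 1#)
          (eqvSum-coh {decompose Γ (flatten y)} {y} (decompose-flatten cg y vy)))
    , (λ Γ Γ' σ cg _ gi x vx → singleton-VecEq eqvSum (decompose Γ' (map σ x)) (relabelSum σ (decompose Γ x)) ≈-refl
          (λ r → cong (λ z → eqvSum z r) (decompose-relabel cg gi vx)))
    , (λ Γ G cg tG x p vx pE → sumVecEq (decompose Γ (substTube G p x)) (actSum G p (decompose (contract Γ G) x))
          (decompose-act cg tG vx pE))
    where
    T⇒≡true : {b : Bool} → T b → b ≡ true
    T⇒≡true = Equivalence.to T-≡
    sumVecEq : (y y' : Sum) → eqvSum y y' ≡ true → VecEq SumModule ((1# , y) ∷ []) ((1# , y') ∷ [])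
    sumVecEq y y' e = singleton-VecEq eqvSum y y' ≈-refl (eqvSum-coh {y} {y'} e)
    permVecEq : (s s' : List ℕ) → rotEq s s' ≡ true → VecEq CycPermM ((1# , s) ∷ []) ((1# , s') ∷ [])
    permVecEq s s' e = singleton-VecEq rotEq s s' ≈-refl (rotEq-coh {s} {s'} e)

theorem3p4p2 : {c ℓ : Level} (K : Field c ℓ)
    → Σ (Graph → BasedModule.R CycPermM → Lin.FVec K (BasedModule.R (CycEqM ⊕M HamCompM))) λ f
    → Σ (Graph → BasedModule.R (CycEqM ⊕M HamCompM) → Lin.FVec K (BasedModule.R CycPermM)) λ g
    → Lin.IsModuleIso K CycPermM (CycEqM ⊕M HamCompM) f g
theorem3p4p2 K = toSum , toPerm , isModuleIso
  where open Iso K
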